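{- For every $r$-colored composition $(\alpha,\epsilon)$ of $n$, there exists a bijection $\mathrm{D}_{(\alpha,\epsilon)} \to \mathrm{SYT}(\boldsymbol{\lambda}_{\mathrm{Z}_{(\alpha,\epsilon)}})$, $(\pi,\mathrm{z}) \mapsto \boldsymbol{Q}$, such that \[ \mathrm{sDes}(\boldsymbol{Q}) = \mathrm{sDes}\left({\overline{(\pi,\mathrm{z})}}^{ -1}\right). \] In particular, the distribution of the colored descent set is the same over the conjugate-inverse colored descent class $\overline{\mathrm{D}}_{(\alpha,\epsilon)}^{ -1}$ and over $\mathrm{SYT}(\boldsymbol{\lambda}_{\mathrm{Z}_{(\alpha,\epsilon)}})$.
   Context: Fix positive integers $n$ and $r$; colors are the elements $0,1,\dots,r-1$ of $\mathbb{Z}_r$, ordered as integers. A composition of $n$ is a sequence of positive integers summing to $n$; its length $\ell(\alpha)$ is its number of parts. For $\alpha=(\alpha_1,\dots,\alpha_k)$, the ribbon (zigzag diagram) $\mathrm{Z}_\alpha$ is the connected skew shape with no $2\times 2$ square whose row lengths, read from bottom to top, are $\alpha_1,\dots,\alpha_k$. An $r$-colored composition of $n$ is a pair $(\alpha,\epsilon)$ with $\alpha$ a composition of $n$ and $\epsilon\in\mathbb{Z}_r^{\ell(\alpha)}$ assigning a color to each part. Its rainbow decomposition is the unique concatenation $(\alpha_{(1)},\epsilon_{(1)})\cdots(\alpha_{(m)},\epsilon_{(m)})$ of nonempty monochromatic colored compositions, $\alpha_{(i)}$ of single color $\epsilon_{(i)}$, with $\epsilon_{(i)}\neq\epsilon_{(i+1)}$.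 The colored zigzag shape of $(\alpha,\epsilon)$ is $\mathrm{Z}_{(\alpha,\epsilon)} = ((\mathrm{Z}_{\alpha_{(1)}},\dots,\mathrm{Z}_{\alpha_{(m)}}),(\epsilon_{(1)},\dots,\epsilon_{(m)}))$, and $\boldsymbol{\lambda}_{\mathrm{Z}_{(\alpha,\epsilon)}} = (Z^{(0)},\dots,Z^{(r-1)})$ is the $r$-partite skew shape with $Z^{(j)}$ the direct sum of those $\mathrm{Z}_{\alpha_{(i)}}$ with $\epsilon_{(i)}=j$ (in order), where the direct sum $\lambda\oplus\mu$ places the diagram of $\mu$ so that its lower-left vertex coincides with the upper-right vertex of $\lambda$. The $r$-colored permutation group $\mathbb{Z}_r\wr\mathfrak{S}_n$ consists of pairs $(\pi,\mathrm{z})$ with $\pi$ a permutation of $[n]$ and $\mathrm{z}\in\mathbb{Z}_r^n$, with product $(\pi,\mathrm{z})(\tau,\mathrm{w})=(\pi\tau,\mathrm{w}+\tau(\mathrm{z}))$, where $\tau(\mathrm{z})=(\mathrm{z}_{\tau_1},\dots,\mathrm{z}_{\tau_n})$; the inverse is $(\pi^{ -1},-\pi^{ -1}(\mathrm{z}))$ and the conjugate is $\overline{(\pi,\mathrm{z})}=(\pi,-\mathrm{z})$, so $\overline{(\pi,\mathrm{z})}^{ -1}=(\pi^{ -1},\pi^{ -1}(\mathrm{z}))$. The colored descent set $\mathrm{sDes}(\pi,\mathrm{z})$ is the pair $(S\cup\{n\},\zeta)$ where $S$ is the set of $i\in[n-1]$ with $\mathrm{z}_i\neq\mathrm{z}_{i+1}$,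 or $\mathrm{z}_i=\mathrm{z}_{i+1}$ and $\pi_i>\pi_{i+1}$, and $\zeta(i)=\mathrm{z}_i$ for $i\in S\cup\{n\}$. Colored subsets $(S\cup\{n\},\zeta)$ of $[n]$ correspond bijectively to $r$-colored compositions (parts are differences of consecutive elements of $S\cup\{n\}$, the part ending at $s$ has color $\zeta(s)$); $\mathrm{co}(\pi,\mathrm{z})$ is the colored composition corresponding to $\mathrm{sDes}(\pi,\mathrm{z})$. The colored descent class is $\mathrm{D}_{(\alpha,\epsilon)}=\{(\pi,\mathrm{z}) : \mathrm{co}(\pi,\mathrm{z})=(\alpha,\epsilon)\}$ and the conjugate-inverse colored descent class is $\overline{\mathrm{D}}_{(\alpha,\epsilon)}^{ -1}=\{(\pi,\mathrm{z}) : \mathrm{co}(\overline{(\pi,\mathrm{z})}^{ -1})=(\alpha,\epsilon)\}$. A standard Young $r$-partite tableau of ($r$-partite, possibly skew) shape $\boldsymbol{\lambda}=(\lambda^{(0)},\dots,\lambda^{(r-1)})$ is an $r$-tuple $\boldsymbol{Q}=(Q^{(0)},\dots,Q^{(r-1)})$ of tableaux, strictly increasing along rows and columns, $Q^{(j)}$ of shape $\lambda^{(j)}$, in which each element of $[n]$ appears exactly once; $\mathrm{SYT}(\boldsymbol{\lambda})$ denotes the set of these. Its colored descent set $\mathrm{sDes}(\boldsymbol{Q})$ is $(S\cup\{n\},\zeta)$ where $S$ is the set of $i\in[n-1]$ such that $i$ and $i+1$ lie in parts of different colors, or lie in the same part with $i+1$ in a lower row than $i$; and $\zeta(i)$ is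 the color $j$ of the part $Q^{(j)}$ containing $i$. -}

module Defs where

open import Data.Nat using (ℕ; zero; suc; _+_; _∸_; _≤_; _<_; _<ᵇ_; _≡ᵇ_)
open import Data.Fin using (Fin; zero; suc; toℕ)
import Data.Fin as F
open import Data.Fin.Permutation using (Permutation′; _⟨$⟩ʳ_; _⟨$⟩ˡ_; flip)
open import Data.Bool using (Bool; true; false; if_then_else_; _∨_; not)
open import Data.Maybe using (Maybe; just; nothing)
import Data.Maybe as M
open import Data.List using (List; []; _∷_; _++_; map; upTo; length; filter; foldr; concatMap; allFin)
open import Data.Nat.ListAction using (sum)
open import Data.List.Relation.Unary.All using (All)
open import Data.List.Relation.Binary.Permutation.Propositional using (_↭_)
open import Data.Vec using (Vec; tabulate; lookup)
import Data.Vec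
import Data.Nat
open import Data.Product using (Σ; _×_; _,_; proj₁; proj₂)
open import Relation.Binary.PropositionalEquality using (_≡_)
open import Relation.Nullary.Decidable using (⌊_⌋)

ColComp : ℕ → Set
ColComp r = List (ℕ × Fin r)

IsColComp : (n r : ℕ) → ColComp r → Set
IsColComp n r αε = All (λ p → 1 ≤ proj₁ p) αε × sum (map proj₁ αε) ≡ n

-- Colored subsets (S ∪ {n}, ζ) of [n], encoded as a vector indexed by
-- Fin n (index i stands for the integer i+1): the entry is  just ζ(i+1)
-- if i+1 ∈ S ∪ {n}, and nothing otherwise.

ColSet : ℕ → ℕ → Set
ColSet n r = Vec (Maybe (Fin r)) n

-- colour of the part ending at position k (1-based), if some part ends there
endCol : ∀ {r} → ColComp r → ℕ → Maybe (Fin r)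
endCol [] k = nothing
endCol ((a , c) ∷ rest) k =
  if k ≡ᵇ a then just c else (if a <ᵇ k then endCol rest (k ∸ a) else nothing)

colSetOf : (n : ℕ) → ∀ {r} → ColComp r → ColSet n r
colSetOf n αε = tabulate (λ i → endCol αε (suc (toℕ i)))

next : ∀ {n} → Fin n → Maybe (Fin n)
next {suc zero} zero = nothing
next {suc (suc n)} zero = just (suc zero)
next {suc (suc n)} (suc i) = M.map suc (next {suc n} i)

sDesGen : ∀ {n r} → (Fin n → Fin r) → (Fin n → Fin n → Bool) → ColSet n r
sDesGen col desc = tabulate λ i → step i (next i)
  where
  step : _ → Maybe _ → Maybe _
  step i nothing = just (col i)
  step i (just j) = if desc i j then just (col i) else nothing

record CPerm (n r : ℕ) : Set where
  constructor _,,_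
  field
    perm : Permutation′ n
    col  : Fin n → Fin r
open CPerm public

_≈P_ : ∀ {n r} → CPerm n r → CPerm n r → Set
x ≈P y = (∀ i → perm x ⟨$⟩ʳ i ≡ perm y ⟨$⟩ʳ i) × (∀ i → col x i ≡ col y i)

conjInv : ∀ {n r} → CPerm n r → CPerm n r
conjInv (π ,, z) = flip π ,, (λ i → z (π ⟨$⟩ˡ i))

sDesP : ∀ {n r} → CPerm n r → ColSet n r
sDesP (π ,, z) = sDesGen z
  (λ i j → not ⌊ z i F.≟ z j ⌋ ∨ ⌊ π ⟨$⟩ʳ j F.<? π ⟨$⟩ʳ i ⌋)

DClass : (n r : ℕ) → ColComp r → Set
DClass n r αε = Σ (CPerm n r) λ x → sDesP x ≡ colSetOf n αε

DbarInvClass : (n r : ℕ) → ColComp r → Set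
DbarInvClass n r αε = Σ (CPerm n r) λ x → sDesP (conjInv x) ≡ colSetOf n αε

-- Skew shapes (English convention: row index grows downwards,
-- column index grows to the right).

record Shape : Set where
  constructor shape
  field
    cells  : List (ℕ × ℕ)
    width  : ℕ
    height : ℕ
open Shape public

emptyShape : Shape
emptyShape = shape [] 0 0

-- ribbon Z_α, row lengths α₁,…,αₖ read from bottom to top; the bottom row
-- occupies columns 0..α₁-1, and the ribbon of (α₂,…) is placed above it,
-- its first column being the last column of the bottom row.
ribbonCells : List ℕ → List (ℕ × ℕ)
ribbonCells [] = []
ribbonCells (a ∷ as) =
  map (λ c → (length as , c)) (upTo a)
  ++ map (λ rc → (proj₁ rc , proj₂ rc + (a ∸ 1))) (ribbonCells as)

ribbon : List ℕ → Shape
ribbon α = shape (ribbonCells α) (suc (sum α) ∸ length α) (length α)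

-- direct sum λ ⊕ μ: lower-left vertex of μ at upper-right vertex of λ
_⊕_ : Shape → Shape → Shape
shape c₁ w₁ h₁ ⊕ shape c₂ w₂ h₂ =
  shape (map (λ rc → (proj₁ rc + h₂ , proj₂ rc)) c₁
         ++ map (λ rc → (proj₁ rc , proj₂ rc + w₁)) c₂)
        (w₁ + w₂) (h₁ + h₂)

rainbow : ∀ {r} → ColComp r → List (List ℕ × Fin r)
rainbow [] = []
rainbow ((a , c) ∷ rest) = go (rainbow rest)
  where
  go : List (List ℕ × _) → List (List ℕ × _)
  go [] = (a ∷ [] , c) ∷ []
  go ((as , c′) ∷ bs) =
    if ⌊ c F.≟ c′ ⌋ then (a ∷ as , c′) ∷ bs else (a ∷ [] , c) ∷ (as , c′) ∷ bs

colourPart : ∀ {r} → ColComp r → Fin r → Shape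
colourPart αε j =
  foldr (λ b s → ribbon (proj₁ b) ⊕ s) emptyShape
        (filter (λ b → proj₂ b F.≟ j) (rainbow αε))

-- the r-partite shape λ_{Z_(α,ε)} as the list of its cells (colour, row, column)
Cell : ℕ → Set
Cell r = Fin r × ℕ × ℕ

zigzagCells : ∀ {r} → ColComp r → List (Cell r)
zigzagCells {r} αε =
  concatMap (λ j → map (λ rc → (j , rc)) (cells (colourPart αε j))) (allFin r)

-- Standard Young r-partite tableaux of an r-partite shape given by its
-- list of cells.  A tableau is encoded by the position of each entry:
-- pos i is the cell containing the integer i+1.

record SYT (n r : ℕ) (sh : List (Cell r)) : Set where
  field
    pos      : Vec (Cell r) n
    filling  : Data.Vec.toList pos ↭ sh
    rowIncr  : ∀ a b → proj₁ (lookup pos a) ≡ proj₁ (lookup pos b)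
               → proj₁ (proj₂ (lookup pos a)) ≡ proj₁ (proj₂ (lookup pos b))
               → proj₂ (proj₂ (lookup pos a)) < proj₂ (proj₂ (lookup pos b))
               → toℕ a < toℕ b
    colIncr  : ∀ a b → proj₁ (lookup pos a) ≡ proj₁ (lookup pos b)
               → proj₂ (proj₂ (lookup pos a)) ≡ proj₂ (proj₂ (lookup pos b))
               → proj₁ (proj₂ (lookup pos a)) < proj₁ (proj₂ (lookup pos b))
               → toℕ a < toℕ b
open SYT public

sDesT : ∀ {n r sh} → SYT n r sh → ColSet n r
sDesT Q = sDesGen (λ i → proj₁ (lookup (pos Q) i))
  (λ i j → not ⌊ proj₁ (lookup (pos Q) i) F.≟ proj₁ (lookup (pos Q) j) ⌋
           ∨ ⌊ proj₁ (proj₂ (lookup (pos Q) i)) Data.Nat.<? proj₁ (proj₂ (lookup (pos Q) j)) ⌋)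

module Submission where

-- List the cells of λ_Z(α,ε) in reading order: the parts of α in turn, each
-- along its row of a ribbon from left to right, and send (π, z) ∈ D_(α,ε) to
-- the tableau with πᵢ in the i-th cell.  Within a part the descent class forces
-- πᵢ < πᵢ₊₁; at the end of a part followed by one of the same colour it forces
-- πᵢ > πᵢ₊₁.  Two cells of one colour lie in the same row only if the positions
-- between them stay inside one part, and in the same column only if every step
-- between them crosses into a next part of that colour, so the tableau is
-- standard; conversely π can be read off any standard tableau.  The entries v and
-- v + 1 of one colour have v + 1 in a lower row exactly when v + 1 comes earlier
-- in the reading order, i.e. when v is a descent of π⁻¹, so sDes of the tableau is
-- sDes of the conjugate-inverse.  Conjugate-inversion is an involution, which
-- transfers everything to the conjugate-inverse descent class.

open import Defs
open import Data.Nat using (ℕ; _≤_)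
open import Data.Product using (Σ; _×_; proj₁)
open import Relation.Binary.PropositionalEquality using (_≡_)

open import Data.Nat using (zero; suc; _+_; _∸_; _<_; _<?_; _≟_; z≤n; s≤s)
import Data.Nat.Properties as ℕ
open import Data.Fin as F using (Fin; toℕ; zero; suc)
import Data.Fin.Properties as F
open import Data.Fin.Permutation using (Permutation′; _⟨$⟩ʳ_; _⟨$⟩ˡ_; inverseˡ; inverseʳ; permutation)
open import Data.Bool using (Bool; true; false; if_then_else_; not; _∨_)
open import Data.Maybe using (Maybe; just; nothing)
import Data.Maybe.Properties as M
import Data.List as L
open import Data.List using (List; []; _∷_; map; _++_; filter; foldr; applyUpTo; upTo; concatMap; concat; allFin; length)
import Data.List.Properties as L
import Data.Vec as V
import Data.Vec.Properties as V
open import Data.Nat.ListAction using (sum)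
open import Data.List.Relation.Unary.All using (All; []; _∷_)
import Data.List.Relation.Unary.All as All
import Data.List.Relation.Unary.All.Properties as All
open import Data.List.Relation.Unary.Any using (here; there)
open import Data.List.Membership.Propositional using (_∈_; _∉_)
import Data.List.Membership.Propositional.Properties as ∈
open import Data.List.Membership.Propositional.Properties.WithK using (unique∧set⇒bag)
open import Data.List.Relation.Unary.Unique.Propositional using (Unique)
open import Data.List.Relation.Unary.AllPairs using ([]; _∷_)
import Data.List.Relation.Unary.Unique.Propositional.Properties as Unique
open import Data.List.Relation.Binary.Permutation.Propositional
  using (_↭_; ↭-prep; ↭-trans; ↭-sym; ↭-reflexive; ↭⇒↭ₛ)
import Data.List.Relation.Binary.Permutation.Propositional.Properties as ↭
import Data.List.Relation.Binary.Permutation.Setoid.Properties as ↭ₛ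
open import Data.List.Relation.Binary.BagAndSetEquality using (∼bag⇒↭)
open import Data.Product using (_,_; proj₂)
open import Data.Sum using (inj₁; inj₂)
open import Data.Empty using (⊥-elim)
open import Function using (_∘_)
open import Function.Bundles using (mk⇔)
open import Relation.Nullary using (Dec; yes; no; ¬_; does)
open import Relation.Nullary.Decidable using (⌊_⌋; dec-true; dec-false)
open import Relation.Binary.PropositionalEquality
  using (refl; sym; trans; cong; cong₂; subst; subst₂; setoid; module ≡-Reasoning)
open import Relation.Binary using (tri<; tri≈; tri>)

module _ {n : ℕ} (π : Permutation′ n) where

  ⟨$⟩ʳ-injective : ∀ {i j} → π ⟨$⟩ʳ i ≡ π ⟨$⟩ʳ j → i ≡ j
  ⟨$⟩ʳ-injective e = trans (sym (inverseˡ π)) (trans (cong (π ⟨$⟩ˡ_) e) (inverseˡ π))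

  ⟨$⟩ˡ-injective : ∀ {i j} → π ⟨$⟩ˡ i ≡ π ⟨$⟩ˡ j → i ≡ j
  ⟨$⟩ˡ-injective e = trans (sym (inverseʳ π)) (trans (cong (π ⟨$⟩ʳ_) e) (inverseʳ π))

  ⟨$⟩ˡ-≗⇒⟨$⟩ʳ-≗ : ∀ σ → (∀ v → π ⟨$⟩ˡ v ≡ σ ⟨$⟩ˡ v) → ∀ i → π ⟨$⟩ʳ i ≡ σ ⟨$⟩ʳ i
  ⟨$⟩ˡ-≗⇒⟨$⟩ʳ-≗ σ ⟨$⟩ˡ≗ i = ⟨$⟩ˡ-injective (trans (inverseˡ π) (sym (trans (⟨$⟩ˡ≗ (σ ⟨$⟩ʳ i)) (inverseˡ σ))))

module _ {A : Set} where

  toList-tabulate : ∀ {n} (f : Fin n → A) → V.toList (V.tabulate f) ≡ L.tabulate f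
  toList-tabulate {zero} f = refl
  toList-tabulate {suc n} f = cong (f zero ∷_) (toList-tabulate (f ∘ suc))

  tabulate-toℕ : ∀ (f : ℕ → A) n → L.tabulate (λ (i : Fin n) → f (toℕ i)) ≡ applyUpTo f n
  tabulate-toℕ f zero = refl
  tabulate-toℕ f (suc n) = cong (f 0 ∷_) (tabulate-toℕ (f ∘ suc) n)

  applyUpTo-+ : ∀ (f : ℕ → A) a m → applyUpTo f (a + m) ≡ applyUpTo f a ++ applyUpTo (f ∘ (a +_)) m
  applyUpTo-+ f zero m = refl
  applyUpTo-+ f (suc a) m = cong (f 0 ∷_) (applyUpTo-+ (f ∘ suc) a m)

  applyUpTo-cong : ∀ {f g : ℕ → A} n → (∀ k → k < n → f k ≡ g k) → applyUpTo f n ≡ applyUpTo g n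
  applyUpTo-cong zero h = refl
  applyUpTo-cong (suc n) h = cong₂ _∷_ (h 0 (s≤s z≤n)) (applyUpTo-cong n (λ k k<n → h (suc k) (s≤s k<n)))

  Unique-tabulate⇒injective : ∀ {n} (f : Fin n → A) → Unique (L.tabulate f) → ∀ i j → f i ≡ f j → i ≡ j
  Unique-tabulate⇒injective f (f0∉ ∷ u) zero zero e = refl
  Unique-tabulate⇒injective f (f0∉ ∷ u) zero (suc j) e = ⊥-elim (All.lookup f0∉ (∈.∈-tabulate⁺ j) e)
  Unique-tabulate⇒injective f (f0∉ ∷ u) (suc i) zero e = ⊥-elim (All.lookup f0∉ (∈.∈-tabulate⁺ i) (sym e))
  Unique-tabulate⇒injective f (f0∉ ∷ u) (suc i) (suc j) e = cong suc (Unique-tabulate⇒injective (f ∘ suc) u i j e)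

  tabulate-permute : ∀ {n} (g : Fin n → A) (σ : Permutation′ n) → (∀ i j → g i ≡ g j → i ≡ j) →
                     L.tabulate (g ∘ (σ ⟨$⟩ˡ_)) ↭ L.tabulate g
  tabulate-permute g σ g-inj = ∼bag⇒↭ (unique∧set⇒bag
    (Unique.tabulate⁺ λ e → ⟨$⟩ˡ-injective σ (g-inj _ _ e))
    (Unique.tabulate⁺ λ e → g-inj _ _ e)
    (mk⇔ (λ x∈ → let (v , e) = ∈.∈-tabulate⁻ x∈ in subst (_∈ _) (sym e) (∈.∈-tabulate⁺ (σ ⟨$⟩ˡ v)))
         (λ x∈ → let (i , e) = ∈.∈-tabulate⁻ x∈ in
                 subst (_∈ _) (trans (cong g (inverseˡ σ)) (sym e)) (∈.∈-tabulate⁺ (σ ⟨$⟩ʳ i)))))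

module _ {A : Set} {r : ℕ} (key : A → Fin r) where

  buckets : List (Fin r) → List A → List A
  buckets js xs = concatMap (λ j → filter (λ x → key x F.≟ j) xs) js

  buckets-[] : ∀ js → buckets js [] ≡ []
  buckets-[] [] = refl
  buckets-[] (j ∷ js) = buckets-[] js

  buckets-∉ : ∀ x xs js → key x ∉ js → buckets js (x ∷ xs) ≡ buckets js xs
  buckets-∉ x xs [] _ = refl
  buckets-∉ x xs (j ∷ js) x∉ with key x F.≟ j
  ... | yes e = ⊥-elim (x∉ (here e))
  ... | no _ = cong (filter (λ y → key y F.≟ j) xs ++_) (buckets-∉ x xs js (x∉ ∘ there))

  buckets-∈ : ∀ x xs js → Unique js → key x ∈ js → buckets js (x ∷ xs) ↭ x ∷ buckets js xs
  buckets-∈ x xs (j ∷ js) (j∉ ∷ u) x∈ with key x F.≟ j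
  ... | yes refl = ↭-prep x (↭-reflexive (cong (_ ++_) (buckets-∉ x xs js (All.All¬⇒¬Any j∉))))
  ... | no ne with x∈
  ...   | here e = ⊥-elim (ne e)
  ...   | there x∈′ = ↭-trans (↭.++⁺ˡ _ (buckets-∈ x xs js u x∈′)) (↭.shift x _ _)

  buckets-allFin : ∀ xs → buckets (allFin r) xs ↭ xs
  buckets-allFin [] = ↭-reflexive (buckets-[] (allFin r))
  buckets-allFin (x ∷ xs) = ↭-trans (buckets-∈ x xs (allFin r) (Unique.allFin⁺ r) (∈.∈-allFin (key x)))
                                    (↭-prep x (buckets-allFin xs))

extend : ∀ {n} → (Fin n → ℕ) → ℕ → ℕ
extend {zero} f t = 0
extend {suc n} f zero = f zero
extend {suc n} f (suc t) = extend (f ∘ suc) t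

extend-toℕ : ∀ {n} (f : Fin n → ℕ) i → extend f (toℕ i) ≡ f i
extend-toℕ {suc n} f zero = refl
extend-toℕ {suc n} f (suc i) = extend-toℕ (f ∘ suc) i

module _ (f : ℕ → ℕ) where

  ascending-chain : ∀ p q → p < q → (∀ t → p ≤ t → t < q → f t < f (suc t)) → f p < f q
  ascending-chain p (suc q) p<1+q step with ℕ.m≤n⇒m<n∨m≡n (ℕ.≤-pred p<1+q)
  ... | inj₁ p<q = ℕ.<-trans (ascending-chain p q p<q λ t p≤t t<q → step t p≤t (ℕ.m<n⇒m<1+n t<q))
                             (step q (ℕ.<⇒≤ p<q) (ℕ.n<1+n q))
  ... | inj₂ refl = step p ℕ.≤-refl (ℕ.n<1+n p)

  descending-chain : ∀ p q → p < q → (∀ t → p ≤ t → t < q → f (suc t) < f t) → f q < f p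
  descending-chain p (suc q) p<1+q step with ℕ.m≤n⇒m<n∨m≡n (ℕ.≤-pred p<1+q)
  ... | inj₁ p<q = ℕ.<-trans (step q (ℕ.<⇒≤ p<q) (ℕ.n<1+n q))
                             (descending-chain p q p<q λ t p≤t t<q → step t p≤t (ℕ.m<n⇒m<1+n t<q))
  ... | inj₂ refl = step p ℕ.≤-refl (ℕ.n<1+n p)

data Split (a p : ℕ) : Set where
  inside : p < a → Split a p
  beyond : ∀ t → p ≡ a + t → Split a p

split : ∀ a p → Split a p
split a p with p <? a
... | yes p<a = inside p<a
... | no p≮a = beyond (p ∸ a) (sym (ℕ.m+[n∸m]≡n (ℕ.≮⇒≥ p≮a)))

data SplitSucc (a t : ℕ) : Set where
  inside : suc t < a → SplitSucc a t
  boundary : suc t ≡ a → SplitSucc a t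
  beyond : ∀ u → t ≡ a + u → SplitSucc a t

splitSucc : ∀ a t → SplitSucc a t
splitSucc a t with split a (suc t)
... | inside 1+t<a = inside 1+t<a
... | beyond zero e = boundary (trans e (ℕ.+-identityʳ a))
... | beyond (suc u) e = beyond u (ℕ.suc-injective (trans e (ℕ.+-suc a u)))

interval-shift : ∀ {P : ℕ → Set} a u v → (∀ w → u ≤ w → w < v → P (a + w)) →
                 ∀ t → a + u ≤ t → t < a + v → P t
interval-shift a u v h t a+u≤t t<a+v with split a t
... | inside t<a = ⊥-elim (ℕ.<⇒≱ t<a (ℕ.≤-trans (ℕ.m≤m+n a u) a+u≤t))
... | beyond w refl = h w (ℕ.+-cancelˡ-≤ a _ _ a+u≤t) (ℕ.+-cancelˡ-< a _ _ t<a+v)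

interval-join : ∀ {P : ℕ → Set} p m q → (∀ t → p ≤ t → t < m → P t) → (∀ t → m ≤ t → t < q → P t) →
                ∀ t → p ≤ t → t < q → P t
interval-join p m q low high t p≤t t<q with t <? m
... | yes t<m = low t p≤t t<m
... | no t≮m = high t (ℕ.≮⇒≥ t≮m) t<q

suc-cancelˡ-< : ∀ a u n → suc (a + u) < a + n → suc u < n
suc-cancelˡ-< a u n h = ℕ.+-cancelˡ-< a _ _ (subst (_< a + n) (sym (ℕ.+-suc a u)) h)

-- Colored descent sets

just≢nothing : ∀ {A : Set} {x : A} → ¬ just x ≡ nothing
just≢nothing ()

data NextView {n} (i : Fin n) : Maybe (Fin n) → Set where
  last : suc (toℕ i) ≡ n → NextView i nothing
  succ : ∀ j → toℕ j ≡ suc (toℕ i) → NextView i (just j)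

nextView : ∀ {n} (i : Fin n) → NextView i (next i)
nextView {suc zero} zero = last refl
nextView {suc (suc n)} zero = succ (suc zero) refl
nextView {suc (suc n)} (suc i) with next i | nextView i
... | nothing | last e = last (cong suc e)
... | just j | succ .j e = succ (suc j) (cong suc e)

next-just : ∀ {n} (i : Fin n) {j} → next i ≡ just j → toℕ j ≡ suc (toℕ i)
next-just i = fromView (nextView i)
  where
  fromView : ∀ {m j} → NextView i m → m ≡ just j → toℕ j ≡ suc (toℕ i)
  fromView (succ _ e) refl = e

next-nothing : ∀ {n} (i : Fin n) → next i ≡ nothing → suc (toℕ i) ≡ n
next-nothing {n} i = fromView (nextView i)
  where
  fromView : ∀ {m} → NextView i m → m ≡ nothing → suc (toℕ i) ≡ n
  fromView (last e) refl = e

adjacent : ∀ {n} t → suc t < n → Σ (Fin n × Fin n) λ (i , j) → toℕ i ≡ t × toℕ j ≡ suc t × next i ≡ just j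
adjacent {n} t 1+t<n = fromView (F.fromℕ< t<n) (F.toℕ-fromℕ< t<n)
  where
  t<n : t < n
  t<n = ℕ.<-trans (ℕ.n<1+n t) 1+t<n
  fromView : ∀ i → toℕ i ≡ t → Σ (Fin n × Fin n) λ (i , j) → toℕ i ≡ t × toℕ j ≡ suc t × next i ≡ just j
  fromView i i≡t with next i in next≡ | nextView i
  ... | nothing | last e = ⊥-elim (ℕ.<-irrefl (trans (cong suc (sym i≡t)) e) 1+t<n)
  ... | just j | succ .j e = (i , j) , i≡t , trans e (cong suc i≡t) , next≡

sDesStep : ∀ {n r} → (Fin n → Fin r) → (Fin n → Fin n → Bool) → Fin n → Maybe (Fin n) → Maybe (Fin r)
sDesStep col desc i nothing = just (col i)
sDesStep col desc i (just j) = if desc i j then just (col i) else nothing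

module _ {n r : ℕ} where

  lookup-sDesGen : ∀ (col : Fin n → Fin r) desc i → V.lookup (sDesGen col desc) i ≡ sDesStep col desc i (next i)
  lookup-sDesGen col desc i with next i | unfolded
    where
    -- with the right-hand side left as _, its type mentions next i, so with can abstract it
    unfolded : V.lookup (sDesGen col desc) i ≡ _
    unfolded = V.lookup∘tabulate _ i
  ... | nothing | e = e
  ... | just j | e = e

  sDesGen-≗ : ∀ (col : Fin n → Fin r) desc f →
              (∀ i → sDesStep col desc i (next i) ≡ f i) → sDesGen col desc ≡ V.tabulate f
  sDesGen-≗ col desc f h =
    trans (sym (V.tabulate∘lookup _)) (V.tabulate-cong λ i → trans (lookup-sDesGen col desc i) (h i))

  sDesGen-cong : ∀ (col col′ : Fin n → Fin r) (desc desc′ : Fin n → Fin n → Bool) → (∀ i → col i ≡ col′ i) →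
                 (∀ i j → next i ≡ just j → desc i j ≡ desc′ i j) → sDesGen col desc ≡ sDesGen col′ desc′
  sDesGen-cong col col′ desc desc′ col≗ desc≗ =
    trans (sDesGen-≗ col desc _ λ i → trans (step≗ i (next i) refl) (sym (lookup-sDesGen col′ desc′ i)))
          (V.tabulate∘lookup _)
    where
    step≗ : ∀ i m → next i ≡ m → sDesStep col desc i m ≡ sDesStep col′ desc′ i m
    step≗ i nothing _ = cong just (col≗ i)
    step≗ i (just j) e rewrite desc≗ i j e | col≗ i = refl

-- The descent tests of sDesP and sDesT decide an implication, e.g. zᵢ ≡ zᵢ₊₁ → πᵢ₊₁ < πᵢ.
_⇒?_ : ∀ {P Q : Set} → Dec P → Dec Q → Bool
p? ⇒? q? = not ⌊ p? ⌋ ∨ ⌊ q? ⌋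

module _ {P Q : Set} where

  ⇒?-true : ∀ (p? : Dec P) (q? : Dec Q) → (P → Q) → (p? ⇒? q?) ≡ true
  ⇒?-true (yes p) (yes q) _ = refl
  ⇒?-true (yes p) (no ¬q) p→q = ⊥-elim (¬q (p→q p))
  ⇒?-true (no ¬p) _ _ = refl

  ⇒?-false : ∀ (p? : Dec P) (q? : Dec Q) → P → ¬ Q → (p? ⇒? q?) ≡ false
  ⇒?-false (yes p) (yes q) _ ¬q = ⊥-elim (¬q q)
  ⇒?-false (yes p) (no _) _ _ = refl
  ⇒?-false (no ¬p) _ p _ = ⊥-elim (¬p p)

  module _ {A : Set} where

    ⇒?-nothing : ∀ (p? : Dec P) (q? : Dec Q) {x : A} → (if p? ⇒? q? then just x else nothing) ≡ nothing → P × ¬ Q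
    ⇒?-nothing (yes p) (no ¬q) _ = p , ¬q
    ⇒?-nothing (yes p) (yes q) ()
    ⇒?-nothing (no ¬p) _ ()

    ⇒?-just : ∀ (p? : Dec P) (q? : Dec Q) {x y : A} → (if p? ⇒? q? then just x else nothing) ≡ just y → x ≡ y × (P → Q)
    ⇒?-just (yes p) (yes q) refl = refl , λ _ → q
    ⇒?-just (yes p) (no ¬q) ()
    ⇒?-just (no ¬p) _ refl = refl , λ p → ⊥-elim (¬p p)

⇒?-cong : ∀ {P P′ Q Q′ : Set} (p? : Dec P) (p′? : Dec P′) (q? : Dec Q) (q′? : Dec Q′) →
          (P → P′) → (P′ → P) → (P → Q → Q′) → (P → Q′ → Q) → (p? ⇒? q?) ≡ (p′? ⇒? q′?)
⇒?-cong (yes p) (yes p′) (yes q) q′? _ _ to _ = sym (⇒?-true (yes p′) q′? λ _ → to p q)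
⇒?-cong (yes p) (yes p′) (no ¬q) q′? _ _ _ from = sym (⇒?-false (yes p′) q′? p′ (¬q ∘ from p))
⇒?-cong (yes p) (no ¬p′) _ _ to _ _ _ = ⊥-elim (¬p′ (to p))
⇒?-cong (no ¬p) (yes p′) _ _ _ from _ _ = ⊥-elim (¬p (from p′))
⇒?-cong (no ¬p) (no ¬p′) _ _ _ _ _ _ = refl

sDesP-conjInv² : ∀ {n r} (x : CPerm n r) → sDesP (conjInv (conjInv x)) ≡ sDesP x
sDesP-conjInv² (π ,, z) = sDesGen-cong _ _ _ _ (λ i → cong z (inverseˡ π))
  λ i j _ → cong₂ (λ a b → (a F.≟ b) ⇒? (π ⟨$⟩ʳ j F.<? π ⟨$⟩ʳ i)) (cong z (inverseˡ π)) (cong z (inverseˡ π))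

conjInv-injective : ∀ {n r} (x y : CPerm n r) → conjInv x ≈P conjInv y → x ≈P y
conjInv-injective (π ,, z) (σ ,, w) (⟨$⟩ˡ≗ , z≗) = π≗ , λ i →
  trans (cong z (sym (inverseˡ π))) (trans (z≗ (π ⟨$⟩ʳ i)) (cong w (trans (cong (σ ⟨$⟩ˡ_) (π≗ i)) (inverseˡ σ))))
  where
  π≗ : ∀ i → π ⟨$⟩ʳ i ≡ σ ⟨$⟩ʳ i
  π≗ = ⟨$⟩ˡ-≗⇒⟨$⟩ʳ-≗ π σ ⟨$⟩ˡ≗

-- The reading word of the zigzag shape

total : ∀ {r} → ColComp r → ℕ
total αε = sum (map proj₁ αε)

Positive : ∀ {r} → ColComp r → Set
Positive = All (λ part → 1 ≤ proj₁ part)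

-- cellAt αε p is the cell of λ_{Z(α,ε)} occupied by position p + 1: the
-- parts are the rows of the ribbons, read from left to right.  A part
-- followed by one of the same colour shares its last column with it, so
-- the later cells of that colour are shifted right by a − 1 instead of a.
-- Beyond the last position cellAt is a junk cell of colour default.
module Reading {r : ℕ} (default : Fin r) where

  colour : Cell r → Fin r
  colour = proj₁

  row column : Cell r → ℕ
  row = proj₁ ∘ proj₂
  column = proj₂ ∘ proj₂

  rowCount : Fin r → ColComp r → ℕ
  rowCount c [] = 0
  rowCount c ((_ , c′) ∷ rest) with c′ F.≟ c
  ... | yes _ = suc (rowCount c rest)
  ... | no _ = rowCount c rest

  continues : Fin r → ColComp r → ℕ
  continues c [] = 0
  continues c ((_ , c′) ∷ _) with c F.≟ c′
  ... | yes _ = 1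
  ... | no _ = 0

  offset : Fin r → ℕ → Fin r → ℕ
  offset c s j = if does (j F.≟ c) then s else 0

  shiftRight : Fin r → ℕ → Cell r → Cell r
  shiftRight c s (j , x , y) = j , x , y + offset c s j

  cellAt : ColComp r → ℕ → Cell r
  cellAt [] p = default , 0 , 0
  cellAt ((a , c) ∷ rest) p with p <? a
  ... | yes _ = c , rowCount c rest , p
  ... | no _ = shiftRight c (a ∸ continues c rest) (cellAt rest (p ∸ a))

  colourAt : ColComp r → ℕ → Fin r
  colourAt αε = colour ∘ cellAt αε

  rowAt columnAt : ColComp r → ℕ → ℕ
  rowAt αε = row ∘ cellAt αε
  columnAt αε = column ∘ cellAt αε

  rowCount-same : ∀ j a c rest → c ≡ j → rowCount j ((a , c) ∷ rest) ≡ suc (rowCount j rest)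
  rowCount-same j a c rest c≡j with c F.≟ j
  ... | yes _ = refl
  ... | no c≢j = ⊥-elim (c≢j c≡j)

  rowCount-other : ∀ j a c rest → ¬ c ≡ j → rowCount j ((a , c) ∷ rest) ≡ rowCount j rest
  rowCount-other j a c rest c≢j with c F.≟ j
  ... | yes c≡j = ⊥-elim (c≢j c≡j)
  ... | no _ = refl

  rowCount-mono : ∀ j a c rest → rowCount j rest ≤ rowCount j ((a , c) ∷ rest)
  rowCount-mono j a c rest with c F.≟ j
  ... | yes _ = ℕ.n≤1+n _
  ... | no _ = ℕ.≤-refl

  continues-same : ∀ c a′ c′ rest′ → c ≡ c′ → continues c ((a′ , c′) ∷ rest′) ≡ 1
  continues-same c a′ c′ rest′ c≡c′ with c F.≟ c′
  ... | yes _ = refl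
  ... | no c≢c′ = ⊥-elim (c≢c′ c≡c′)

  continues-other : ∀ c a′ c′ rest′ → ¬ c ≡ c′ → continues c ((a′ , c′) ∷ rest′) ≡ 0
  continues-other c a′ c′ rest′ c≢c′ with c F.≟ c′
  ... | yes c≡c′ = ⊥-elim (c≢c′ c≡c′)
  ... | no _ = refl

  offset-same : ∀ c s → offset c s c ≡ s
  offset-same c s with c F.≟ c
  ... | yes _ = refl
  ... | no c≢c = ⊥-elim (c≢c refl)

  offset-other : ∀ c s j → ¬ j ≡ c → offset c s j ≡ 0
  offset-other c s j j≢c with j F.≟ c
  ... | yes j≡c = ⊥-elim (j≢c j≡c)
  ... | no _ = refl

  module _ (a : ℕ) (c : Fin r) (rest : ColComp r) where

    private
      shift : Cell r → Cell r
      shift = shiftRight c (a ∸ continues c rest)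

    cellAt-inside : ∀ p → p < a → cellAt ((a , c) ∷ rest) p ≡ (c , rowCount c rest , p)
    cellAt-inside p p<a with p <? a
    ... | yes _ = refl
    ... | no p≮a = ⊥-elim (p≮a p<a)

    cellAt-beyond : ∀ t → cellAt ((a , c) ∷ rest) (a + t) ≡ shift (cellAt rest t)
    cellAt-beyond t with (a + t) <? a
    ... | yes a+t<a = ⊥-elim (ℕ.m+n≮m a t a+t<a)
    ... | no _ = cong (shift ∘ cellAt rest) (ℕ.m+n∸m≡n a t)

    cellAt-next : cellAt ((a , c) ∷ rest) a ≡ shift (cellAt rest 0)
    cellAt-next = trans (cong (cellAt _) (sym (ℕ.+-identityʳ a))) (cellAt-beyond 0)

    colourAt-inside : ∀ p → p < a → colourAt ((a , c) ∷ rest) p ≡ c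
    colourAt-inside p p<a = cong colour (cellAt-inside p p<a)

    rowAt-inside : ∀ p → p < a → rowAt ((a , c) ∷ rest) p ≡ rowCount c rest
    rowAt-inside p p<a = cong row (cellAt-inside p p<a)

    columnAt-inside : ∀ p → p < a → columnAt ((a , c) ∷ rest) p ≡ p
    columnAt-inside p p<a = cong column (cellAt-inside p p<a)

    colourAt-beyond : ∀ t → colourAt ((a , c) ∷ rest) (a + t) ≡ colourAt rest t
    colourAt-beyond t = cong colour (cellAt-beyond t)

    colourAt-beyond-suc : ∀ t → colourAt ((a , c) ∷ rest) (suc (a + t)) ≡ colourAt rest (suc t)
    colourAt-beyond-suc t = trans (cong (colourAt ((a , c) ∷ rest)) (sym (ℕ.+-suc a t))) (colourAt-beyond (suc t))

    rowAt-beyond : ∀ t → rowAt ((a , c) ∷ rest) (a + t) ≡ rowAt rest t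
    rowAt-beyond t = cong row (cellAt-beyond t)

    columnAt-beyond : ∀ t → columnAt ((a , c) ∷ rest) (a + t) ≡ columnAt rest t + offset c (a ∸ continues c rest) (colourAt rest t)
    columnAt-beyond t = cong column (cellAt-beyond t)

    endCol-inside : ∀ t → suc t < a → endCol ((a , c) ∷ rest) (suc t) ≡ nothing
    endCol-inside t 1+t<a
      rewrite dec-false (suc t ≟ a) (ℕ.<⇒≢ 1+t<a) | dec-false (a <? suc t) (ℕ.<-asym 1+t<a) = refl

    endCol-at : endCol ((a , c) ∷ rest) a ≡ just c
    endCol-at rewrite dec-true (a ≟ a) refl = refl

    endCol-beyond : ∀ t → endCol ((a , c) ∷ rest) (suc (a + t)) ≡ endCol rest (suc t)
    endCol-beyond t
      rewrite dec-false (suc (a + t) ≟ a) (ℕ.<⇒≢ (s≤s (ℕ.m≤m+n a t)) ∘ sym)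
            | dec-true (a <? suc (a + t)) (s≤s (ℕ.m≤m+n a t))
            | ℕ.+-∸-assoc 1 (ℕ.m≤m+n a t) | ℕ.m+n∸m≡n a t = refl

    columnAt-beyond-common : ∀ u v → colourAt rest u ≡ colourAt rest v → Σ ℕ λ δ →
      columnAt ((a , c) ∷ rest) (a + u) ≡ columnAt rest u + δ × columnAt ((a , c) ∷ rest) (a + v) ≡ columnAt rest v + δ
    columnAt-beyond-common u v e =
      _ , columnAt-beyond u , trans (columnAt-beyond v) (cong (λ j → columnAt rest v + offset c _ j) (sym e))

  colourAt-next : ∀ a c a′ c′ rest′ → 1 ≤ a′ → colourAt ((a , c) ∷ (a′ , c′) ∷ rest′) a ≡ c′
  colourAt-next a c a′ c′ rest′ 1≤a′ = trans (cong colour (cellAt-next a c _)) (colourAt-inside a′ c′ rest′ 0 1≤a′)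

  -- shiftRight commutes with both definitionally.
  rightOf below : Cell r → Cell r
  rightOf (j , x , y) = j , x , suc y
  below (j , x , y) = j , suc x , y

  -- endCol αε (suc t) ≢ nothing says that a part ends at the 0-based position t.
  OnePart MonochromeBreaks : ColComp r → ℕ → ℕ → Set
  OnePart αε p q = ∀ t → p ≤ t → t < q → endCol αε (suc t) ≡ nothing
  MonochromeBreaks αε p q = ∀ t → p ≤ t → t < q →
    endCol αε (suc t) ≡ just (colourAt αε t) × colourAt αε (suc t) ≡ colourAt αε t

  module _ (a : ℕ) (c : Fin r) (rest : ColComp r) where

    onePart-beyond : ∀ u v → OnePart rest u v → OnePart ((a , c) ∷ rest) (a + u) (a + v)
    onePart-beyond u v h = interval-shift a u v λ w u≤w w<v → trans (endCol-beyond a c rest w) (h w u≤w w<v)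

    monochromeBreaks-beyond : ∀ u v → MonochromeBreaks rest u v → MonochromeBreaks ((a , c) ∷ rest) (a + u) (a + v)
    monochromeBreaks-beyond u v h = interval-shift a u v λ w u≤w w<v →
      trans (endCol-beyond a c rest w) (trans (proj₁ (h w u≤w w<v)) (cong just (sym (colourAt-beyond a c rest w)))) ,
      trans (colourAt-beyond-suc a c rest w) (trans (proj₂ (h w u≤w w<v)) (sym (colourAt-beyond a c rest w)))

  rowAt<rowCount : ∀ αε p c → p < total αε → colourAt αε p ≡ c → rowAt αε p < rowCount c αε
  rowAt<rowCount ((a , c′) ∷ rest) p .(colourAt ((a , c′) ∷ rest) p) p<N refl with split a p
  ... | inside p<a rewrite cellAt-inside a c′ rest p p<a = ℕ.≤-reflexive (sym (rowCount-same c′ a c′ rest refl))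
  ... | beyond u refl rewrite cellAt-beyond a c′ rest u =
    ℕ.<-≤-trans (rowAt<rowCount rest u _ (ℕ.+-cancelˡ-< a _ _ p<N) refl) (rowCount-mono _ a c′ rest)

  rowAt-antitone : ∀ αε p q → p < q → q < total αε → colourAt αε p ≡ colourAt αε q → rowAt αε q ≤ rowAt αε p
  rowAt-antitone ((a , c) ∷ rest) p q p<q q<N ec with split a p | split a q
  ... | inside p<a | inside q<a rewrite cellAt-inside a c rest p p<a | cellAt-inside a c rest q q<a = ℕ.≤-refl
  ... | inside p<a | beyond v refl =
    subst₂ _≤_ (sym (rowAt-beyond a c rest v)) (sym (rowAt-inside a c rest p p<a))
      (ℕ.<⇒≤ (rowAt<rowCount rest v c (ℕ.+-cancelˡ-< a _ _ q<N)
                (trans (sym (colourAt-beyond a c rest v)) (trans (sym ec) (colourAt-inside a c rest p p<a)))))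
  ... | beyond u refl | inside q<a = ⊥-elim (ℕ.<⇒≱ q<a (ℕ.≤-trans (ℕ.m≤m+n a u) (ℕ.<⇒≤ p<q)))
  ... | beyond u refl | beyond v refl rewrite cellAt-beyond a c rest u | cellAt-beyond a c rest v =
    rowAt-antitone rest u v (ℕ.+-cancelˡ-< a _ _ p<q) (ℕ.+-cancelˡ-< a _ _ q<N) ec

  sameRow⇒onePart×columnAt< : ∀ αε p q → p < q → q < total αε →
    colourAt αε p ≡ colourAt αε q → rowAt αε p ≡ rowAt αε q → OnePart αε p q × columnAt αε p < columnAt αε q
  sameRow⇒onePart×columnAt< ((a , c) ∷ rest) p q p<q q<N ec er with split a p | split a q
  ... | inside p<a | inside q<a =
    (λ t _ t<q → endCol-inside a c rest t (ℕ.≤-<-trans t<q q<a)) ,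
    subst₂ _<_ (sym (columnAt-inside a c rest p p<a)) (sym (columnAt-inside a c rest q q<a)) p<q
  ... | inside p<a | beyond v refl = ⊥-elim (ℕ.<-irrefl
    (trans (sym (rowAt-beyond a c rest v)) (trans (sym er) (rowAt-inside a c rest p p<a)))
    (rowAt<rowCount rest v c (ℕ.+-cancelˡ-< a _ _ q<N)
      (trans (sym (colourAt-beyond a c rest v)) (trans (sym ec) (colourAt-inside a c rest p p<a)))))
  ... | beyond u refl | inside q<a = ⊥-elim (ℕ.<⇒≱ q<a (ℕ.≤-trans (ℕ.m≤m+n a u) (ℕ.<⇒≤ p<q)))
  ... | beyond u refl | beyond v refl =
    let (δ , eu , ev) = columnAt-beyond-common a c rest u v ecr in
    onePart-beyond a c rest u v (proj₁ ih) , subst₂ _<_ (sym eu) (sym ev) (ℕ.+-monoˡ-< δ (proj₂ ih))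
    where
    ecr : colourAt rest u ≡ colourAt rest v
    ecr = trans (sym (colourAt-beyond a c rest u)) (trans ec (colourAt-beyond a c rest v))
    ih : OnePart rest u v × columnAt rest u < columnAt rest v
    ih = sameRow⇒onePart×columnAt< rest u v (ℕ.+-cancelˡ-< a _ _ p<q) (ℕ.+-cancelˡ-< a _ _ q<N) ecr
           (trans (sym (rowAt-beyond a c rest u)) (trans er (rowAt-beyond a c rest v)))

  cellAt-distinct : ∀ αε p q → p < q → q < total αε → ¬ cellAt αε p ≡ cellAt αε q
  cellAt-distinct αε p q p<q q<N e = ℕ.<-irrefl (cong column e)
    (proj₂ (sameRow⇒onePart×columnAt< αε p q p<q q<N (cong colour e) (cong row e)))

  noEnd⇒rightOf : ∀ αε t → suc t < total αε → endCol αε (suc t) ≡ nothing → cellAt αε (suc t) ≡ rightOf (cellAt αε t)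
  noEnd⇒rightOf ((a , c) ∷ rest) t 1+t<N noEnd with splitSucc a t
  ... | inside 1+t<a
    rewrite cellAt-inside a c rest (suc t) 1+t<a | cellAt-inside a c rest t (ℕ.<-trans (ℕ.n<1+n t) 1+t<a) = refl
  ... | boundary refl = ⊥-elim (just≢nothing (trans (sym (endCol-at (suc t) c rest)) noEnd))
  ... | beyond u refl = begin
    cellAt αε (suc (a + u))               ≡⟨ cong (cellAt αε) (sym (ℕ.+-suc a u)) ⟩
    cellAt αε (a + suc u)                 ≡⟨ cellAt-beyond a c rest (suc u) ⟩
    shift (cellAt rest (suc u))           ≡⟨ cong shift (noEnd⇒rightOf rest u 1+u<N′ noEnd′) ⟩
    rightOf (shift (cellAt rest u))       ≡⟨ cong rightOf (sym (cellAt-beyond a c rest u)) ⟩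
    rightOf (cellAt αε (a + u))           ∎
    where
    open ≡-Reasoning
    αε = (a , c) ∷ rest
    shift = shiftRight c (a ∸ continues c rest)
    1+u<N′ : suc u < total rest
    1+u<N′ = suc-cancelˡ-< a u _ 1+t<N
    noEnd′ : endCol rest (suc u) ≡ nothing
    noEnd′ = trans (sym (endCol-beyond a c rest u)) noEnd

  endCol⇒colourAt : ∀ αε t {c₀} → endCol αε (suc t) ≡ just c₀ → colourAt αε t ≡ c₀
  endCol⇒colourAt ((a , c) ∷ rest) t end with splitSucc a t
  ... | inside 1+t<a = ⊥-elim (just≢nothing (trans (sym end) (endCol-inside a c rest t 1+t<a)))
  ... | boundary refl =
    trans (colourAt-inside (suc t) c rest t (ℕ.n<1+n t)) (M.just-injective (trans (sym (endCol-at (suc t) c rest)) end))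
  ... | beyond u refl =
    trans (colourAt-beyond a c rest u) (endCol⇒colourAt rest u (trans (sym (endCol-beyond a c rest u)) end))

  endCol-total : ∀ αε t → suc t ≡ total αε → endCol αε (suc t) ≡ just (colourAt αε t)
  endCol-total ((a , c) ∷ rest) t 1+t≡N with splitSucc a t
  ... | inside 1+t<a = ⊥-elim (ℕ.<⇒≱ 1+t<a (subst (a ≤_) (sym 1+t≡N) (ℕ.m≤m+n a _)))
  ... | boundary refl = trans (endCol-at (suc t) c rest) (cong just (sym (colourAt-inside (suc t) c rest t (ℕ.n<1+n t))))
  ... | beyond u refl =
    trans (endCol-beyond a c rest u)
          (trans (endCol-total rest u (ℕ.+-cancelˡ-≡ a _ _ (trans (ℕ.+-suc a u) 1+t≡N)))
                 (cong just (sym (colourAt-beyond a c rest u))))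

  private
    below-nextPart : ∀ t c a′ rest′ → 1 ≤ a′ →
      let αε = (suc t , c) ∷ (a′ , c) ∷ rest′ in cellAt αε t ≡ below (cellAt αε (suc t))
    below-nextPart t c a′ rest′ 1≤a′
      rewrite cellAt-inside (suc t) c ((a′ , c) ∷ rest′) t (ℕ.n<1+n t)
            | cellAt-next (suc t) c ((a′ , c) ∷ rest′)
            | cellAt-inside a′ c rest′ 0 1≤a′
            | continues-same c a′ c rest′ refl
            | rowCount-same c a′ c rest′ refl
            | offset-same c t
      = refl

  sameColourEnd⇒below : ∀ αε → Positive αε → ∀ t {c₀} → suc t < total αε → endCol αε (suc t) ≡ just c₀ →
                        colourAt αε (suc t) ≡ colourAt αε t → cellAt αε t ≡ below (cellAt αε (suc t))
  sameColourEnd⇒below ((a , c) ∷ rest) (_ ∷ pos) t 1+t<N end ec with splitSucc a t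
  ... | inside 1+t<a = ⊥-elim (just≢nothing (trans (sym end) (endCol-inside a c rest t 1+t<a)))
  sameColourEnd⇒below ((_ , c) ∷ []) _ t 1+t<N _ _ | boundary refl =
    ⊥-elim (ℕ.<-irrefl (sym (ℕ.+-identityʳ (suc t))) 1+t<N)
  sameColourEnd⇒below ((_ , c) ∷ (a′ , c′) ∷ rest′) (_ ∷ 1≤a′ ∷ _) t _ _ ec | boundary refl
    with trans (sym (colourAt-next (suc t) c a′ c′ rest′ 1≤a′)) (trans ec (colourAt-inside (suc t) c _ t (ℕ.n<1+n t)))
  ... | refl = below-nextPart t c a′ rest′ 1≤a′
  sameColourEnd⇒below ((a , c) ∷ rest) (_ ∷ pos) t 1+t<N end ec | beyond u refl = begin
    cellAt αε (a + u)                     ≡⟨ cellAt-beyond a c rest u ⟩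
    shift (cellAt rest u)                 ≡⟨ cong shift (sameColourEnd⇒below rest pos u 1+u<N′ end′ ec′) ⟩
    below (shift (cellAt rest (suc u)))   ≡⟨ cong below (sym (cellAt-beyond a c rest (suc u))) ⟩
    below (cellAt αε (a + suc u))         ≡⟨ cong (below ∘ cellAt αε) (ℕ.+-suc a u) ⟩
    below (cellAt αε (suc (a + u)))       ∎
    where
    open ≡-Reasoning
    αε = (a , c) ∷ rest
    shift = shiftRight c (a ∸ continues c rest)
    1+u<N′ : suc u < total rest
    1+u<N′ = suc-cancelˡ-< a u _ 1+t<N
    end′ : endCol rest (suc u) ≡ just _
    end′ = trans (sym (endCol-beyond a c rest u)) end
    ec′ : colourAt rest (suc u) ≡ colourAt rest u
    ec′ = trans (sym (colourAt-beyond-suc a c rest u)) (trans ec (colourAt-beyond a c rest u))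

  -- The first part shares a column with a later cell only through its last
  -- position, and only if the next part has the same colour.
  private
    sameColumn-acrossFirstPart : ∀ a c rest → 1 ≤ a → Positive rest →
      (∀ u v → u < v → v < total rest → colourAt rest u ≡ colourAt rest v → columnAt rest u ≡ columnAt rest v →
         MonochromeBreaks rest u v) →
      ∀ p v → p < a → a + v < a + total rest →
      colourAt ((a , c) ∷ rest) p ≡ colourAt ((a , c) ∷ rest) (a + v) →
      columnAt ((a , c) ∷ rest) p ≡ columnAt ((a , c) ∷ rest) (a + v) → MonochromeBreaks ((a , c) ∷ rest) p (a + v)
    sameColumn-acrossFirstPart a c [] _ _ _ p v _ q<N _ _ = ⊥-elim (ℕ.n≮0 (ℕ.+-cancelˡ-< a _ _ q<N))
    sameColumn-acrossFirstPart a@(suc a₀) c rest@((a′ , c′) ∷ rest′) _ (1≤a′ ∷ _) ih p v p<a q<N ec ecol =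
      byColour (c F.≟ c′)
      where
      αε = (a , c) ∷ rest
      colourAt-v : colourAt rest v ≡ c
      colourAt-v = trans (sym (colourAt-beyond a c rest v)) (trans (sym ec) (colourAt-inside a c rest p p<a))
      pColumnAt : p ≡ columnAt rest v + (a ∸ continues c rest)
      pColumnAt = trans (sym (columnAt-inside a c rest p p<a))
        (trans ecol (trans (columnAt-beyond a c rest v)
          (cong (columnAt rest v +_) (trans (cong (offset c _) colourAt-v) (offset-same c _)))))
      byColour : Dec (c ≡ c′) → MonochromeBreaks αε p (a + v)
      byColour (no c≢c′) = ⊥-elim (ℕ.<⇒≱ p<a (subst (a ≤_) (sym pColumn) (ℕ.m≤n+m a (columnAt rest v))))
        where
        pColumn : p ≡ columnAt rest v + a
        pColumn = trans pColumnAt (cong (λ k → columnAt rest v + (a ∸ k)) (continues-other c a′ c′ rest′ c≢c′))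
      byColour (yes c≡c′) = interval-join p a (a + v) atEnd
                              (subst (λ m → MonochromeBreaks αε m (a + v)) (ℕ.+-identityʳ a)
                                     (monochromeBreaks-beyond a c rest 0 v breaksRest))
        where
        colourAt-0 : colourAt rest 0 ≡ c
        colourAt-0 = trans (colourAt-inside a′ c′ rest′ 0 1≤a′) (sym c≡c′)
        pColumn : p ≡ columnAt rest v + a₀
        pColumn = trans pColumnAt (cong (λ k → columnAt rest v + (a ∸ k)) (continues-same c a′ c′ rest′ c≡c′))
        columnAt-v≡0 : columnAt rest v ≡ 0
        columnAt-v≡0 = ℕ.n≤0⇒n≡0 (ℕ.+-cancelʳ-≤ a₀ _ 0 (subst (_≤ a₀) pColumn (ℕ.≤-pred p<a)))
        p≡a₀ : p ≡ a₀
        p≡a₀ = trans pColumn (cong (_+ a₀) columnAt-v≡0)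
        atEnd : ∀ t → p ≤ t → t < a → endCol αε (suc t) ≡ just (colourAt αε t) × colourAt αε (suc t) ≡ colourAt αε t
        atEnd t p≤t t<a with ℕ.≤-antisym (subst (_≤ t) p≡a₀ p≤t) (ℕ.≤-pred t<a)
        ... | refl = trans (endCol-at a c rest) (cong just (sym (colourAt-inside a c rest a₀ (ℕ.n<1+n a₀)))) ,
                     trans (colourAt-next a c a′ c′ rest′ 1≤a′) (trans (sym c≡c′) (sym (colourAt-inside a c rest a₀ (ℕ.n<1+n a₀))))
        breaksRest : MonochromeBreaks rest 0 v
        breaksRest w _ w<v = ih 0 v (ℕ.≤-<-trans z≤n w<v) (ℕ.+-cancelˡ-< a _ _ q<N)
          (trans colourAt-0 (sym colourAt-v))
          (trans (columnAt-inside a′ c′ rest′ 0 1≤a′) (sym columnAt-v≡0)) w z≤n w<v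

  sameColumn⇒monochromeBreaks : ∀ αε → Positive αε → ∀ p q → p < q → q < total αε →
    colourAt αε p ≡ colourAt αε q → columnAt αε p ≡ columnAt αε q → MonochromeBreaks αε p q
  sameColumn⇒monochromeBreaks ((a , c) ∷ rest) (1≤a ∷ pos) p q p<q q<N ec ecol with split a p | split a q
  ... | inside p<a | inside q<a =
    ⊥-elim (ℕ.<-irrefl (trans (sym (columnAt-inside a c rest p p<a)) (trans ecol (columnAt-inside a c rest q q<a))) p<q)
  ... | inside p<a | beyond v refl =
    sameColumn-acrossFirstPart a c rest 1≤a pos (sameColumn⇒monochromeBreaks rest pos) p v p<a q<N ec ecol
  ... | beyond u refl | inside q<a = ⊥-elim (ℕ.<⇒≱ q<a (ℕ.≤-trans (ℕ.m≤m+n a u) (ℕ.<⇒≤ p<q)))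
  ... | beyond u refl | beyond v refl =
    monochromeBreaks-beyond a c rest u v
      (sameColumn⇒monochromeBreaks rest pos u v (ℕ.+-cancelˡ-< a _ _ p<q) (ℕ.+-cancelˡ-< a _ _ q<N) ecr ecolr)
    where
    ecr : colourAt rest u ≡ colourAt rest v
    ecr = trans (sym (colourAt-beyond a c rest u)) (trans ec (colourAt-beyond a c rest v))
    ecolr : columnAt rest u ≡ columnAt rest v
    ecolr = let (δ , eu , ev) = columnAt-beyond-common a c rest u v ecr in
            ℕ.+-cancelʳ-≡ δ _ _ (trans (sym eu) (trans ecol ev))

  readingCells : ColComp r → List (Cell r)
  readingCells [] = []
  readingCells ((a , c) ∷ rest) =
    map (λ k → c , rowCount c rest , k) (upTo a) ++ map (shiftRight c (a ∸ continues c rest)) (readingCells rest)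

  applyUpTo-cellAt : ∀ αε → applyUpTo (cellAt αε) (total αε) ≡ readingCells αε
  applyUpTo-cellAt [] = refl
  applyUpTo-cellAt ((a , c) ∷ rest) = begin
    applyUpTo (cellAt αε) (a + total rest)
      ≡⟨ applyUpTo-+ (cellAt αε) a (total rest) ⟩
    applyUpTo (cellAt αε) a ++ applyUpTo (cellAt αε ∘ (a +_)) (total rest)
      ≡⟨ cong₂ _++_ (trans (applyUpTo-cong a (cellAt-inside a c rest)) (sym (L.map-upTo _ a)))
                    (trans (applyUpTo-cong (total rest) (λ t _ → cellAt-beyond a c rest t))
                           (sym (L.map-applyUpTo (cellAt rest) shift (total rest)))) ⟩
    map (λ k → c , rowCount c rest , k) (upTo a) ++ map shift (applyUpTo (cellAt rest) (total rest))
      ≡⟨ cong (λ xs → map (λ k → c , rowCount c rest , k) (upTo a) ++ map shift xs) (applyUpTo-cellAt rest) ⟩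
    readingCells αε ∎
    where
    open ≡-Reasoning
    αε = (a , c) ∷ rest
    shift = shiftRight c (a ∸ continues c rest)

  colourShape : Fin r → List (List ℕ × Fin r) → Shape
  colourShape j bs = foldr (λ b s → ribbon (proj₁ b) ⊕ s) emptyShape (filter (λ b → proj₂ b F.≟ j) bs)

  colourShape-same : ∀ j c as bs → c ≡ j → colourShape j ((as , c) ∷ bs) ≡ ribbon as ⊕ colourShape j bs
  colourShape-same j c as bs c≡j with c F.≟ j
  ... | yes _ = refl
  ... | no c≢j = ⊥-elim (c≢j c≡j)

  colourShape-other : ∀ j c as bs → ¬ c ≡ j → colourShape j ((as , c) ∷ bs) ≡ colourShape j bs
  colourShape-other j c as bs c≢j with c F.≟ j
  ... | yes c≡j = ⊥-elim (c≢j c≡j)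
  ... | no _ = refl

  rainbow-head : ∀ a c rest → Σ (List ℕ) λ as → Σ (List (List ℕ × Fin r)) λ bs →
                 rainbow ((a , c) ∷ rest) ≡ (a ∷ as , c) ∷ bs
  rainbow-head a c rest with rainbow rest
  ... | [] = [] , [] , refl
  ... | (as , c′) ∷ bs with c F.≟ c′
  ...   | yes refl = as , bs , refl
  ...   | no _ = [] , (as , c′) ∷ bs , refl

  data RainbowView (a : ℕ) (c : Fin r) (rest : ColComp r) : Set where
    newBlock : rainbow ((a , c) ∷ rest) ≡ (a ∷ [] , c) ∷ rainbow rest → continues c rest ≡ 0 → RainbowView a c rest
    extendBlock : ∀ as bs → rainbow rest ≡ (as , c) ∷ bs → rainbow ((a , c) ∷ rest) ≡ (a ∷ as , c) ∷ bs →
                  continues c rest ≡ 1 → RainbowView a c rest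

  rainbowView : ∀ a c rest → RainbowView a c rest
  rainbowView a c [] = newBlock refl refl
  rainbowView a c ((a′ , c′) ∷ rest′) with rainbow-head a′ c′ rest′ | c F.≟ c′
  ... | as , bs , eq | yes refl = extendBlock (a′ ∷ as) bs eq extended (continues-same c a′ c rest′ refl)
    where
    extended : rainbow ((a , c) ∷ (a′ , c) ∷ rest′) ≡ (a ∷ a′ ∷ as , c) ∷ bs
    extended rewrite eq with c F.≟ c
    ... | yes _ = refl
    ... | no c≢c = ⊥-elim (c≢c refl)
  ... | as , bs , eq | no c≢c′ = newBlock new (continues-other c a′ c′ rest′ c≢c′)
    where
    new : rainbow ((a , c) ∷ (a′ , c′) ∷ rest′) ≡ (a ∷ [] , c) ∷ rainbow ((a′ , c′) ∷ rest′)
    new rewrite eq with c F.≟ c′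
    ... | yes c≡c′ = ⊥-elim (c≢c′ c≡c′)
    ... | no _ = refl

  height-colourShape : ∀ αε j → height (colourShape j (rainbow αε)) ≡ rowCount j αε
  height-colourShape [] j = refl
  height-colourShape ((a , c) ∷ rest) j with rainbowView a c rest
  ... | newBlock eq _ = trans (cong (height ∘ colourShape j) eq) (byColour (c F.≟ j))
    where
    byColour : Dec (c ≡ j) → height (colourShape j ((a ∷ [] , c) ∷ rainbow rest)) ≡ rowCount j ((a , c) ∷ rest)
    byColour (yes c≡j) = trans (cong height (colourShape-same j c _ _ c≡j))
                               (trans (cong suc (height-colourShape rest j)) (sym (rowCount-same j a c rest c≡j)))
    byColour (no c≢j) = trans (cong height (colourShape-other j c _ _ c≢j))
                              (trans (height-colourShape rest j) (sym (rowCount-other j a c rest c≢j)))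
  ... | extendBlock as bs eqRest eq _ = trans (cong (height ∘ colourShape j) eq) (byColour (c F.≟ j))
    where
    ih : height (colourShape j ((as , c) ∷ bs)) ≡ rowCount j rest
    ih = trans (cong (height ∘ colourShape j) (sym eqRest)) (height-colourShape rest j)
    byColour : Dec (c ≡ j) → height (colourShape j ((a ∷ as , c) ∷ bs)) ≡ rowCount j ((a , c) ∷ rest)
    byColour (yes c≡j) = trans (cong height (colourShape-same j c _ _ c≡j))
      (trans (cong suc (trans (cong height (sym (colourShape-same j c as bs c≡j))) ih)) (sym (rowCount-same j a c rest c≡j)))
    byColour (no c≢j) = trans (cong height (colourShape-other j c _ _ c≢j))
      (trans (trans (cong height (sym (colourShape-other j c as bs c≢j))) ih) (sym (rowCount-other j a c rest c≢j)))

  rainbow-length≤sum : ∀ αε → Positive αε → All (λ b → length (proj₁ b) ≤ sum (proj₁ b)) (rainbow αε)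
  rainbow-length≤sum [] _ = []
  rainbow-length≤sum ((a , c) ∷ rest) (1≤a ∷ pos) with rainbowView a c rest | rainbow-length≤sum rest pos
  ... | newBlock eq _ | ih rewrite eq = subst (1 ≤_) (sym (ℕ.+-identityʳ a)) 1≤a ∷ ih
  ... | extendBlock as bs eqRest eq _ | ih rewrite eq | eqRest with ih
  ...   | as-ok ∷ bs-ok = ℕ.+-mono-≤ 1≤a as-ok ∷ bs-ok

  right : ℕ → ℕ × ℕ → ℕ × ℕ
  right s (x , y) = x , y + s

  ribbon-single-⊕ : ∀ a S → cells (ribbon (a ∷ []) ⊕ S) ≡ map (λ k → height S , k) (upTo a) ++ map (right a) (cells S)
  ribbon-single-⊕ a S =
    cong₂ _++_ (trans (cong (map _) (L.++-identityʳ _)) (sym (L.map-∘ (upTo a))))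
               (L.map-cong (λ rc → cong (λ w → proj₁ rc , proj₂ rc + w) (ℕ.+-identityʳ a)) (cells S))

  ribbon-cons-⊕ : ∀ a₀ as S → length as ≤ sum as → cells (ribbon (suc a₀ ∷ as) ⊕ S) ≡
    map (λ k → length as + height S , k) (upTo (suc a₀)) ++ map (right a₀) (cells (ribbon as ⊕ S))
  ribbon-cons-⊕ a₀ as S len≤sum = begin
    map raise (X ++ map (right a₀) R) ++ map (right W) (cells S)
      ≡⟨ cong (_++ map (right W) (cells S)) (L.map-++ raise X _) ⟩
    (map raise X ++ map raise (map (right a₀) R)) ++ map (right W) (cells S)
      ≡⟨ L.++-assoc (map raise X) _ _ ⟩
    map raise X ++ (map raise (map (right a₀) R) ++ map (right W) (cells S))
      ≡⟨ cong₂ (λ xs ys → xs ++ (ys ++ map (right W) (cells S)))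
               (sym (L.map-∘ (upTo (suc a₀)))) (trans (sym (L.map-∘ R)) (L.map-∘ R)) ⟩
    map (λ k → length as + height S , k) (upTo (suc a₀)) ++ (map (right a₀) (map raise R) ++ map (right W) (cells S))
      ≡⟨ cong (λ ys → map (λ k → length as + height S , k) (upTo (suc a₀)) ++ (map (right a₀) (map raise R) ++ ys))
              (trans (L.map-cong (λ rc → cong (proj₁ rc ,_) (column-shift {proj₂ rc})) (cells S))
                     (L.map-∘ {g = right a₀} {f = right W′} (cells S))) ⟩
    map (λ k → length as + height S , k) (upTo (suc a₀)) ++ (map (right a₀) (map raise R) ++ map (right a₀) (map (right W′) (cells S)))
      ≡⟨ cong (map (λ k → length as + height S , k) (upTo (suc a₀)) ++_)
              (sym (L.map-++ (right a₀) (map raise R) (map (right W′) (cells S)))) ⟩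
    map (λ k → length as + height S , k) (upTo (suc a₀)) ++ map (right a₀) (cells (ribbon as ⊕ S)) ∎
    where
    open ≡-Reasoning
    R = ribbonCells as
    X = map (λ k → length as , k) (upTo (suc a₀))
    raise : ℕ × ℕ → ℕ × ℕ
    raise rc = proj₁ rc + height S , proj₂ rc
    W W′ : ℕ
    W = suc (suc a₀ + sum as) ∸ suc (length as)
    W′ = suc (sum as) ∸ length as
    W≡W′+a₀ : W ≡ W′ + a₀
    W≡W′+a₀ = begin
      suc (a₀ + sum as) ∸ length as   ≡⟨ cong (_∸ length as) (sym (ℕ.+-suc a₀ (sum as))) ⟩
      a₀ + suc (sum as) ∸ length as   ≡⟨ ℕ.+-∸-assoc a₀ (ℕ.m≤n⇒m≤1+n len≤sum) ⟩
      a₀ + W′                         ≡⟨ ℕ.+-comm a₀ W′ ⟩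
      W′ + a₀                         ∎
    column-shift : ∀ {y} → y + W ≡ y + W′ + a₀
    column-shift {y} = trans (cong (y +_) W≡W′+a₀) (sym (ℕ.+-assoc y W′ a₀))

  cells-colourShape-cons : ∀ a c rest → 1 ≤ a → Positive rest →
    cells (colourShape c (rainbow ((a , c) ∷ rest))) ≡
    map (λ k → rowCount c rest , k) (upTo a) ++ map (right (a ∸ continues c rest)) (cells (colourShape c (rainbow rest)))
  cells-colourShape-cons a c rest _ pos with rainbowView a c rest
  ... | newBlock eq cont≡0
    rewrite eq | cont≡0 | colourShape-same c c (a ∷ []) (rainbow rest) refl | sym (height-colourShape rest c) =
    ribbon-single-⊕ a (colourShape c (rainbow rest))
  cells-colourShape-cons (suc a₀) c rest (s≤s z≤n) pos | extendBlock as bs eqRest eq cont≡1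
    rewrite eq | cont≡1 | sym (height-colourShape rest c) | eqRest
          | colourShape-same c c (suc a₀ ∷ as) bs refl | colourShape-same c c as bs refl =
    ribbon-cons-⊕ a₀ as (colourShape c bs) (All.head (subst (All _) eqRest (rainbow-length≤sum rest pos)))

  colourShape-rainbow-other : ∀ j a c rest → ¬ c ≡ j → colourShape j (rainbow ((a , c) ∷ rest)) ≡ colourShape j (rainbow rest)
  colourShape-rainbow-other j a c rest c≢j with rainbowView a c rest
  ... | newBlock eq _ = trans (cong (colourShape j) eq) (colourShape-other j c _ _ c≢j)
  ... | extendBlock as bs eqRest eq _ =
    trans (cong (colourShape j) eq)
          (trans (colourShape-other j c _ _ c≢j) (trans (sym (colourShape-other j c as bs c≢j)) (cong (colourShape j) (sym eqRest))))

  map-shiftRight-same : ∀ c s X → map (shiftRight c s) (map (c ,_) X) ≡ map (c ,_) (map (right s) X)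
  map-shiftRight-same c s X =
    trans (sym (L.map-∘ X)) (trans (L.map-cong (λ rc → cong (λ o → c , proj₁ rc , proj₂ rc + o) (offset-same c s)) X) (L.map-∘ X))

  map-shiftRight-other : ∀ j c s X → ¬ j ≡ c → map (shiftRight c s) (map (j ,_) X) ≡ map (j ,_) X
  map-shiftRight-other j c s X j≢c =
    trans (sym (L.map-∘ X))
          (L.map-cong (λ rc → cong (λ y → j , proj₁ rc , y) (trans (cong (proj₂ rc +_) (offset-other c s j j≢c)) (ℕ.+-identityʳ _))) X)

  ofColour? : (j : Fin r) (x : Cell r) → Dec (colour x ≡ j)
  ofColour? j x = colour x F.≟ j

  filter-shiftRight : ∀ j c s xs → filter (ofColour? j) (map (shiftRight c s) xs) ≡ map (shiftRight c s) (filter (ofColour? j) xs)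
  filter-shiftRight j c s [] = refl
  filter-shiftRight j c s (x ∷ xs) with ofColour? j x
  ... | yes _ = cong (shiftRight c s x ∷_) (filter-shiftRight j c s xs)
  ... | no _ = filter-shiftRight j c s xs

  filter-readingCells : ∀ αε → Positive αε → ∀ j →
    filter (ofColour? j) (readingCells αε) ≡ map (j ,_) (cells (colourShape j (rainbow αε)))
  filter-readingCells [] _ j = refl
  filter-readingCells ((a , c) ∷ rest) (1≤a ∷ pos) j with c F.≟ j
  ... | yes refl = begin
    filter (ofColour? c) (map K (upTo a) ++ map shift (readingCells rest))
      ≡⟨ L.filter-++ (ofColour? c) (map K (upTo a)) _ ⟩
    filter (ofColour? c) (map K (upTo a)) ++ filter (ofColour? c) (map shift (readingCells rest))
      ≡⟨ cong₂ _++_ (L.filter-all (ofColour? c) (All.map⁺ (All.universal (λ _ → refl) (upTo a))))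
                    (filter-shiftRight c c s (readingCells rest)) ⟩
    map K (upTo a) ++ map shift (filter (ofColour? c) (readingCells rest))
      ≡⟨ cong (λ xs → map K (upTo a) ++ map shift xs) (filter-readingCells rest pos c) ⟩
    map K (upTo a) ++ map shift (map (c ,_) (cells (colourShape c (rainbow rest))))
      ≡⟨ cong₂ _++_ (L.map-∘ (upTo a)) (map-shiftRight-same c s _) ⟩
    map (c ,_) (map (λ k → rowCount c rest , k) (upTo a)) ++ map (c ,_) (map (right s) (cells (colourShape c (rainbow rest))))
      ≡⟨ sym (L.map-++ (c ,_) (map (λ k → rowCount c rest , k) (upTo a)) _) ⟩
    map (c ,_) (map (λ k → rowCount c rest , k) (upTo a) ++ map (right s) (cells (colourShape c (rainbow rest))))
      ≡⟨ cong (map (c ,_)) (sym (cells-colourShape-cons a c rest 1≤a pos)) ⟩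
    map (c ,_) (cells (colourShape c (rainbow ((a , c) ∷ rest)))) ∎
    where
    open ≡-Reasoning
    K = λ k → c , rowCount c rest , k
    s = a ∸ continues c rest
    shift = shiftRight c s
  ... | no c≢j = begin
    filter (ofColour? j) (map K (upTo a) ++ map shift (readingCells rest))
      ≡⟨ L.filter-++ (ofColour? j) (map K (upTo a)) _ ⟩
    filter (ofColour? j) (map K (upTo a)) ++ filter (ofColour? j) (map shift (readingCells rest))
      ≡⟨ cong₂ _++_ (L.filter-none (ofColour? j) (All.map⁺ (All.universal (λ _ → c≢j) (upTo a))))
                    (filter-shiftRight j c s (readingCells rest)) ⟩
    map shift (filter (ofColour? j) (readingCells rest))
      ≡⟨ cong (map shift) (filter-readingCells rest pos j) ⟩
    map shift (map (j ,_) (cells (colourShape j (rainbow rest))))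
      ≡⟨ map-shiftRight-other j c s _ (c≢j ∘ sym) ⟩
    map (j ,_) (cells (colourShape j (rainbow rest)))
      ≡⟨ cong (map (j ,_) ∘ cells) (sym (colourShape-rainbow-other j a c rest c≢j)) ⟩
    map (j ,_) (cells (colourShape j (rainbow ((a , c) ∷ rest)))) ∎
    where
    open ≡-Reasoning
    K = λ k → c , rowCount c rest , k
    s = a ∸ continues c rest
    shift = shiftRight c s

  zigzagCells↭readingCells : ∀ αε → Positive αε → zigzagCells αε ↭ readingCells αε
  zigzagCells↭readingCells αε pos =
    ↭-trans (↭-reflexive (cong concat (L.map-cong (λ j → sym (filter-readingCells αε pos j)) (allFin r))))
            (buckets-allFin colour (readingCells αε))

-- The bijection

module Bijection {r : ℕ} (default : Fin r) (αε : ColComp r) (positive : Positive αε) where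
  open Reading default

  n : ℕ
  n = total αε

  cellOf : Fin n → Cell r
  cellOf i = cellAt αε (toℕ i)

  cellOf-injective : ∀ i j → cellOf i ≡ cellOf j → i ≡ j
  cellOf-injective i j e with ℕ.<-cmp (toℕ i) (toℕ j)
  ... | tri< i<j _ _ = ⊥-elim (cellAt-distinct αε _ _ i<j (F.toℕ<n j) e)
  ... | tri≈ _ i≡j _ = F.toℕ-injective i≡j
  ... | tri> _ _ j<i = ⊥-elim (cellAt-distinct αε _ _ j<i (F.toℕ<n i) (sym e))

  tabulate-cellOf↭zigzagCells : L.tabulate cellOf ↭ zigzagCells αε
  tabulate-cellOf↭zigzagCells =
    ↭-trans (↭-reflexive (trans (tabulate-toℕ (cellAt αε) n) (applyUpTo-cellAt αε))) (↭-sym (zigzagCells↭readingCells αε positive))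

  module ToTableau (π : Permutation′ n) (z : Fin n → Fin r) (inD : sDesP (π ,, z) ≡ colSetOf n αε) where

    desc : Fin n → Fin n → Bool
    desc i j = (z i F.≟ z j) ⇒? (π ⟨$⟩ʳ j F.<? π ⟨$⟩ʳ i)

    step≡endCol : ∀ i → sDesStep z desc i (next i) ≡ endCol αε (suc (toℕ i))
    step≡endCol i = trans (sym (lookup-sDesGen z desc i)) (trans (cong (λ v → V.lookup v i) inD) (V.lookup∘tabulate _ i))

    step≡endCol-next : ∀ i j → next i ≡ just j → (if desc i j then just (z i) else nothing) ≡ endCol αε (suc (toℕ i))
    step≡endCol-next i j e = trans (cong (sDesStep z desc i) (sym e)) (step≡endCol i)

    noEnd⇒ascent : ∀ i j → next i ≡ just j → endCol αε (suc (toℕ i)) ≡ nothing →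
                   z i ≡ z j × toℕ (π ⟨$⟩ʳ i) < toℕ (π ⟨$⟩ʳ j)
    noEnd⇒ascent i j e noEnd with ⇒?-nothing (z i F.≟ z j) (π ⟨$⟩ʳ j F.<? π ⟨$⟩ʳ i) (trans (step≡endCol-next i j e) noEnd)
    ... | zi≡zj , ¬descent = zi≡zj , ℕ.≤∧≢⇒< (ℕ.≮⇒≥ ¬descent) πi≢πj
      where
      πi≢πj : ¬ toℕ (π ⟨$⟩ʳ i) ≡ toℕ (π ⟨$⟩ʳ j)
      πi≢πj eq = ℕ.1+n≢n (trans (sym (next-just i e)) (cong toℕ (sym (⟨$⟩ʳ-injective π (F.toℕ-injective eq)))))

    end⇒colour×descent : ∀ i j {c} → next i ≡ just j → endCol αε (suc (toℕ i)) ≡ just c →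
                          z i ≡ c × (z i ≡ z j → toℕ (π ⟨$⟩ʳ j) < toℕ (π ⟨$⟩ʳ i))
    end⇒colour×descent i j e end = ⇒?-just (z i F.≟ z j) (π ⟨$⟩ʳ j F.<? π ⟨$⟩ʳ i) (trans (step≡endCol-next i j e) end)

    z≡colourAt : ∀ i → z i ≡ colourAt αε (toℕ i)
    z≡colourAt i = fromEnd (n ∸ toℕ i) i (ℕ.m+[n∸m]≡n (ℕ.<⇒≤ (F.toℕ<n i)))
      where
      fromEnd : ∀ m i → toℕ i + m ≡ n → z i ≡ colourAt αε (toℕ i)
      fromEnd zero i eq = ⊥-elim (ℕ.<-irrefl (trans (sym (ℕ.+-identityʳ _)) eq) (F.toℕ<n i))
      fromEnd (suc m) i eq with next i in e
      ... | nothing = M.just-injective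
        (trans (trans (sym (cong (sDesStep z desc i) e)) (step≡endCol i)) (endCol-total αε (toℕ i) (next-nothing i e)))
      ... | just j with endCol αε (suc (toℕ i)) in end
      ...   | just c = trans (proj₁ (end⇒colour×descent i j e end)) (sym (endCol⇒colourAt αε (toℕ i) end))
      ...   | nothing = trans (proj₁ (noEnd⇒ascent i j e end)) (trans (fromEnd m j eq′)
                          (trans (cong (colourAt αε) (next-just i e)) (cong colour (noEnd⇒rightOf αε (toℕ i) 1+i<n end))))
        where
        1+i<n : suc (toℕ i) < n
        1+i<n = subst (_< n) (next-just i e) (F.toℕ<n j)
        eq′ : toℕ j + m ≡ n
        eq′ = trans (cong (_+ m) (next-just i e)) (trans (sym (ℕ.+-suc (toℕ i) m)) eq)

    valueAt : ℕ → ℕ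
    valueAt = extend (λ i → toℕ (π ⟨$⟩ʳ i))

    module _ (t : ℕ) (1+t<n : suc t < n) where

      private
        i j : Fin n
        i = proj₁ (proj₁ (adjacent t 1+t<n))
        j = proj₂ (proj₁ (adjacent t 1+t<n))
        i≡t : toℕ i ≡ t
        i≡t = proj₁ (proj₂ (adjacent t 1+t<n))
        j≡1+t : toℕ j ≡ suc t
        j≡1+t = proj₁ (proj₂ (proj₂ (adjacent t 1+t<n)))
        i→j : next i ≡ just j
        i→j = proj₂ (proj₂ (proj₂ (adjacent t 1+t<n)))
        valueAt-i : valueAt t ≡ toℕ (π ⟨$⟩ʳ i)
        valueAt-i = trans (cong valueAt (sym i≡t)) (extend-toℕ _ i)
        valueAt-j : valueAt (suc t) ≡ toℕ (π ⟨$⟩ʳ j)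
        valueAt-j = trans (cong valueAt (sym j≡1+t)) (extend-toℕ _ j)

      ascent : endCol αε (suc t) ≡ nothing → valueAt t < valueAt (suc t)
      ascent noEnd = subst₂ _<_ (sym valueAt-i) (sym valueAt-j)
        (proj₂ (noEnd⇒ascent i j i→j (subst (λ u → endCol αε (suc u) ≡ nothing) (sym i≡t) noEnd)))

      descent : endCol αε (suc t) ≡ just (colourAt αε t) → colourAt αε (suc t) ≡ colourAt αε t → valueAt (suc t) < valueAt t
      descent end same = subst₂ _<_ (sym valueAt-j) (sym valueAt-i)
        (proj₂ (end⇒colour×descent i j i→j (subst (λ u → endCol αε (suc u) ≡ just (colourAt αε t)) (sym i≡t) end))
          (trans (z≡colourAt i) (trans (cong (colourAt αε) i≡t)
            (trans (sym same) (trans (cong (colourAt αε) (sym j≡1+t)) (sym (z≡colourAt j)))))))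

    sameRow⇒valueAt< : ∀ p q → p < n → q < n → colourAt αε p ≡ colourAt αε q → rowAt αε p ≡ rowAt αε q →
                       columnAt αε p < columnAt αε q → valueAt p < valueAt q
    sameRow⇒valueAt< p q p<n q<n ec er col< with ℕ.<-cmp p q
    ... | tri< p<q _ _ = ascending-chain valueAt p q p<q λ t p≤t t<q →
      ascent t (ℕ.≤-<-trans t<q q<n) (proj₁ (sameRow⇒onePart×columnAt< αε p q p<q q<n ec er) t p≤t t<q)
    ... | tri≈ _ refl _ = ⊥-elim (ℕ.<-irrefl refl col<)
    ... | tri> _ _ q<p = ⊥-elim (ℕ.<-asym col< (proj₂ (sameRow⇒onePart×columnAt< αε q p q<p p<n (sym ec) (sym er))))

    sameColumn⇒valueAt< : ∀ p q → p < n → q < n → colourAt αε p ≡ colourAt αε q → columnAt αε p ≡ columnAt αε q →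
                          rowAt αε p < rowAt αε q → valueAt p < valueAt q
    sameColumn⇒valueAt< p q p<n q<n ec ecol row< with ℕ.<-cmp p q
    ... | tri< p<q _ _ = ⊥-elim (ℕ.<⇒≱ row< (rowAt-antitone αε p q p<q q<n ec))
    ... | tri≈ _ refl _ = ⊥-elim (ℕ.<-irrefl refl row<)
    ... | tri> _ _ q<p = descending-chain valueAt q p q<p λ t q≤t t<p →
      let (end , same) = sameColumn⇒monochromeBreaks αε positive q p q<p p<n (sym ec) (sym ecol) t q≤t t<p in
      descent t (ℕ.≤-<-trans t<p p<n) end same

    entryCell : Fin n → Cell r
    entryCell v = cellOf (π ⟨$⟩ˡ v)

    entries : V.Vec (Cell r) n
    entries = V.tabulate entryCell

    valueAt-⟨$⟩ˡ : ∀ v → valueAt (toℕ (π ⟨$⟩ˡ v)) ≡ toℕ v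
    valueAt-⟨$⟩ˡ v = trans (extend-toℕ _ (π ⟨$⟩ˡ v)) (cong toℕ (inverseʳ π))

    rows-increase : ∀ a b → colour (V.lookup entries a) ≡ colour (V.lookup entries b) →
      row (V.lookup entries a) ≡ row (V.lookup entries b) → column (V.lookup entries a) < column (V.lookup entries b) →
      toℕ a < toℕ b
    rows-increase a b rewrite V.lookup∘tabulate entryCell a | V.lookup∘tabulate entryCell b = λ ec er col< →
      subst₂ _<_ (valueAt-⟨$⟩ˡ a) (valueAt-⟨$⟩ˡ b) (sameRow⇒valueAt< _ _ (F.toℕ<n _) (F.toℕ<n _) ec er col<)

    columns-increase : ∀ a b → colour (V.lookup entries a) ≡ colour (V.lookup entries b) →
      column (V.lookup entries a) ≡ column (V.lookup entries b) → row (V.lookup entries a) < row (V.lookup entries b) →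
      toℕ a < toℕ b
    columns-increase a b rewrite V.lookup∘tabulate entryCell a | V.lookup∘tabulate entryCell b = λ ec ecol row< →
      subst₂ _<_ (valueAt-⟨$⟩ˡ a) (valueAt-⟨$⟩ˡ b) (sameColumn⇒valueAt< _ _ (F.toℕ<n _) (F.toℕ<n _) ec ecol row<)

    tableau : SYT n r (zigzagCells αε)
    tableau = record
      { pos = entries
      ; filling = ↭-trans (↭-reflexive (toList-tabulate entryCell))
                          (↭-trans (tabulate-permute cellOf π cellOf-injective) tabulate-cellOf↭zigzagCells)
      ; rowIncr = rows-increase
      ; colIncr = columns-increase
      }

    colour-entries : ∀ v → colour (V.lookup entries v) ≡ z (π ⟨$⟩ˡ v)
    colour-entries v = trans (cong colour (V.lookup∘tabulate entryCell v)) (sym (z≡colourAt (π ⟨$⟩ˡ v)))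

    module _ (v w : Fin n) (v→w : next v ≡ just w) where

      private
        p q : ℕ
        p = toℕ (π ⟨$⟩ˡ v)
        q = toℕ (π ⟨$⟩ˡ w)

      lowerRow⇒earlier : colourAt αε p ≡ colourAt αε q → rowAt αε p < rowAt αε q → q < p
      lowerRow⇒earlier ec row< with ℕ.<-cmp p q
      ... | tri< p<q _ _ = ⊥-elim (ℕ.<⇒≱ row< (rowAt-antitone αε p q p<q (F.toℕ<n _) ec))
      ... | tri≈ _ p≡q _ = ⊥-elim (ℕ.<-irrefl (cong (rowAt αε) p≡q) row<)
      ... | tri> _ _ q<p = q<p

      earlier⇒lowerRow : colourAt αε p ≡ colourAt αε q → q < p → rowAt αε p < rowAt αε q
      earlier⇒lowerRow ec q<p = ℕ.≤∧≢⇒< (rowAt-antitone αε q p q<p (F.toℕ<n _) (sym ec)) λ er →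
        ℕ.<-asym (subst₂ _<_ (valueAt-⟨$⟩ˡ w) (valueAt-⟨$⟩ˡ v) (sameRow⇒valueAt< q p (F.toℕ<n _) (F.toℕ<n _) (sym ec) (sym er)
                   (proj₂ (sameRow⇒onePart×columnAt< αε q p q<p (F.toℕ<n _) (sym ec) (sym er)))))
                 (subst (toℕ v <_) (sym (next-just v v→w)) (ℕ.n<1+n (toℕ v)))

    tableau-sDes : sDesT tableau ≡ sDesP (conjInv (π ,, z))
    tableau-sDes = sDesGen-cong _ _ _ _ colour-entries λ v w v→w →
      ⇒?-cong (colour (V.lookup entries v) F.≟ colour (V.lookup entries w)) (z (π ⟨$⟩ˡ v) F.≟ z (π ⟨$⟩ˡ w))
              (row (V.lookup entries v) <? row (V.lookup entries w)) (π ⟨$⟩ˡ w F.<? π ⟨$⟩ˡ v)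
        (λ ec → trans (sym (colour-entries v)) (trans ec (colour-entries w)))
        (λ ez → trans (colour-entries v) (trans ez (sym (colour-entries w))))
        (λ ec → subst₂ (λ x y → row x < row y → toℕ (π ⟨$⟩ˡ w) < toℕ (π ⟨$⟩ˡ v))
                  (sym (V.lookup∘tabulate entryCell v)) (sym (V.lookup∘tabulate entryCell w))
                  (lowerRow⇒earlier v w v→w (cellColours ec)))
        (λ ec → subst₂ (λ x y → toℕ (π ⟨$⟩ˡ w) < toℕ (π ⟨$⟩ˡ v) → row x < row y)
                  (sym (V.lookup∘tabulate entryCell v)) (sym (V.lookup∘tabulate entryCell w))
                  (earlier⇒lowerRow v w v→w (cellColours ec)))
      where
      cellColours : ∀ {v w} → colour (V.lookup entries v) ≡ colour (V.lookup entries w) →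
                    colourAt αε (toℕ (π ⟨$⟩ˡ v)) ≡ colourAt αε (toℕ (π ⟨$⟩ˡ w))
      cellColours {v} {w} ec = trans (sym (cong colour (V.lookup∘tabulate entryCell v)))
                                     (trans ec (cong colour (V.lookup∘tabulate entryCell w)))

  toTableau : DClass n r αε → SYT n r (zigzagCells αε)
  toTableau (x , inD) = ToTableau.tableau (perm x) (col x) inD

  toTableau-sDes : ∀ x → sDesT (toTableau x) ≡ sDesP (conjInv (proj₁ x))
  toTableau-sDes (x , inD) = ToTableau.tableau-sDes (perm x) (col x) inD

  toTableau-injective : ∀ x y → pos (toTableau x) ≡ pos (toTableau y) → proj₁ x ≈P proj₁ y
  toTableau-injective (x , inDx) (y , inDy) e =
    ⟨$⟩ˡ-≗⇒⟨$⟩ʳ-≗ (perm x) (perm y) ⟨$⟩ˡ≗ ,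
    λ i → trans (ToTableau.z≡colourAt (perm x) (col x) inDx i) (sym (ToTableau.z≡colourAt (perm y) (col y) inDy i))
    where
    ⟨$⟩ˡ≗ : ∀ v → perm x ⟨$⟩ˡ v ≡ perm y ⟨$⟩ˡ v
    ⟨$⟩ˡ≗ v = cellOf-injective _ _
      (trans (sym (V.lookup∘tabulate _ v)) (trans (cong (λ es → V.lookup es v) e) (V.lookup∘tabulate _ v)))

  module FromTableau (Q : SYT n r (zigzagCells αε)) where

    entries↭cells : L.tabulate (V.lookup (pos Q)) ↭ L.tabulate cellOf
    entries↭cells =
      ↭-trans (↭-reflexive (trans (sym (toList-tabulate _)) (cong V.toList (V.tabulate∘lookup (pos Q)))))
              (↭-trans (filling Q) (↭-sym tabulate-cellOf↭zigzagCells))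

    lookup-injective : ∀ a b → V.lookup (pos Q) a ≡ V.lookup (pos Q) b → a ≡ b
    lookup-injective = Unique-tabulate⇒injective _
      (↭ₛ.Unique-resp-↭ (setoid (Cell r)) (↭⇒↭ₛ (↭-sym entries↭cells)) (Unique.tabulate⁺ λ {i} {j} → cellOf-injective i j))

    positionOf : ∀ v → Σ (Fin n) λ i → V.lookup (pos Q) v ≡ cellOf i
    positionOf v = ∈.∈-tabulate⁻ (↭.∈-resp-↭ entries↭cells (∈.∈-tabulate⁺ v))

    entryOf : ∀ i → Σ (Fin n) λ v → cellOf i ≡ V.lookup (pos Q) v
    entryOf i = ∈.∈-tabulate⁻ (↭.∈-resp-↭ (↭-sym entries↭cells) (∈.∈-tabulate⁺ i))

    π : Permutation′ n
    π = permutation (proj₁ ∘ entryOf) (proj₁ ∘ positionOf)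
          (λ v → lookup-injective _ _ (trans (sym (proj₂ (entryOf _))) (sym (proj₂ (positionOf v)))))
          (λ i → cellOf-injective _ _ (trans (sym (proj₂ (positionOf _))) (sym (proj₂ (entryOf i)))))

    z : Fin n → Fin r
    z i = colourAt αε (toℕ i)

    entry-cell : ∀ i → V.lookup (pos Q) (π ⟨$⟩ʳ i) ≡ cellOf i
    entry-cell i = sym (proj₂ (entryOf i))

    rows-increase : ∀ i j → colour (cellOf i) ≡ colour (cellOf j) → row (cellOf i) ≡ row (cellOf j) →
                    column (cellOf i) < column (cellOf j) → toℕ (π ⟨$⟩ʳ i) < toℕ (π ⟨$⟩ʳ j)
    rows-increase i j ec er col< = rowIncr Q _ _
      (subst₂ (λ x y → colour x ≡ colour y) (sym (entry-cell i)) (sym (entry-cell j)) ec)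
      (subst₂ (λ x y → row x ≡ row y) (sym (entry-cell i)) (sym (entry-cell j)) er)
      (subst₂ (λ x y → column x < column y) (sym (entry-cell i)) (sym (entry-cell j)) col<)

    columns-increase : ∀ i j → colour (cellOf i) ≡ colour (cellOf j) → column (cellOf i) ≡ column (cellOf j) →
                       row (cellOf i) < row (cellOf j) → toℕ (π ⟨$⟩ʳ i) < toℕ (π ⟨$⟩ʳ j)
    columns-increase i j ec ecol row< = colIncr Q _ _
      (subst₂ (λ x y → colour x ≡ colour y) (sym (entry-cell i)) (sym (entry-cell j)) ec)
      (subst₂ (λ x y → column x ≡ column y) (sym (entry-cell i)) (sym (entry-cell j)) ecol)
      (subst₂ (λ x y → row x < row y) (sym (entry-cell i)) (sym (entry-cell j)) row<)

    desc : Fin n → Fin n → Bool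
    desc i j = (z i F.≟ z j) ⇒? (π ⟨$⟩ʳ j F.<? π ⟨$⟩ʳ i)

    step≡endCol : ∀ i → sDesStep z desc i (next i) ≡ endCol αε (suc (toℕ i))
    step≡endCol i with next i in i→j
    ... | nothing = sym (endCol-total αε (toℕ i) (next-nothing i i→j))
    ... | just j with endCol αε (suc (toℕ i)) in end
    ...   | nothing = cong (λ b → if b then just (z i) else nothing)
                           (⇒?-false (z i F.≟ z j) (π ⟨$⟩ʳ j F.<? π ⟨$⟩ʳ i) (sym (cong colour j-right)) (ℕ.<-asym ascending))
      where
      j-right : cellOf j ≡ rightOf (cellOf i)
      j-right = trans (cong (cellAt αε) (next-just i i→j))
                      (noEnd⇒rightOf αε (toℕ i) (subst (_< n) (next-just i i→j) (F.toℕ<n j)) end)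
      ascending : toℕ (π ⟨$⟩ʳ i) < toℕ (π ⟨$⟩ʳ j)
      ascending = rows-increase i j (sym (cong colour j-right)) (sym (cong row j-right))
                    (subst (column (cellOf i) <_) (sym (cong column j-right)) (ℕ.n<1+n _))
    ...   | just c = trans (cong (λ b → if b then just (z i) else nothing)
                                 (⇒?-true (z i F.≟ z j) (π ⟨$⟩ʳ j F.<? π ⟨$⟩ʳ i) descending))
                           (cong just (endCol⇒colourAt αε (toℕ i) end))
      where
      j≡1+i : cellOf j ≡ cellAt αε (suc (toℕ i))
      j≡1+i = cong (cellAt αε) (next-just i i→j)
      descending : z i ≡ z j → toℕ (π ⟨$⟩ʳ j) < toℕ (π ⟨$⟩ʳ i)
      descending ez = columns-increase j i (sym (cong colour i-below)) (sym (cong column i-below))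
                        (subst (row (cellOf j) <_) (cong row (sym i-below)) (ℕ.n<1+n _))
        where
        i-below : cellOf i ≡ below (cellOf j)
        i-below = trans (sameColourEnd⇒below αε positive (toℕ i) (subst (_< n) (next-just i i→j) (F.toℕ<n j)) end
                          (trans (cong (colourAt αε) (sym (next-just i i→j))) (sym ez)))
                        (cong below (sym j≡1+i))

    preimage : DClass n r αε
    preimage = (π ,, z) , sDesGen-≗ z desc _ step≡endCol

    toTableau-preimage : pos (toTableau preimage) ≡ pos Q
    toTableau-preimage = trans (V.tabulate-cong (λ v → sym (proj₂ (positionOf v)))) (V.tabulate∘lookup (pos Q))

  toTableau-surjective : ∀ Q → Σ (DClass n r αε) λ x → pos (toTableau x) ≡ pos Q
  toTableau-surjective Q = FromTableau.preimage Q , FromTableau.toTableau-preimage Q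

  fromConjInv : DbarInvClass n r αε → SYT n r (zigzagCells αε)
  fromConjInv (x , inD) = toTableau (conjInv x , inD)

  fromConjInv-sDes : ∀ x → sDesT (fromConjInv x) ≡ sDesP (proj₁ x)
  fromConjInv-sDes (x , inD) = trans (toTableau-sDes (conjInv x , inD)) (sDesP-conjInv² x)

  fromConjInv-injective : ∀ x y → pos (fromConjInv x) ≡ pos (fromConjInv y) → proj₁ x ≈P proj₁ y
  fromConjInv-injective (x , inDx) (y , inDy) e = conjInv-injective x y (toTableau-injective (conjInv x , inDx) (conjInv y , inDy) e)

  fromConjInv-surjective : ∀ Q → Σ (DbarInvClass n r αε) λ x → pos (fromConjInv x) ≡ pos Q
  fromConjInv-surjective Q =
    let ((x , inD) , e) = toTableau-surjective Q in (conjInv x , trans (sDesP-conjInv² x) inD) , e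

proposition4p3 : (n r : ℕ) → 1 ≤ n → 1 ≤ r → (αε : ColComp r) → IsColComp n r αε
    → Σ (DClass n r αε → SYT n r (zigzagCells αε)) (λ f
        → (∀ x y → pos (f x) ≡ pos (f y) → proj₁ x ≈P proj₁ y)
        × (∀ (Q : SYT n r (zigzagCells αε)) → Σ (DClass n r αε) λ x → pos (f x) ≡ pos Q)
        × (∀ x → sDesT (f x) ≡ sDesP (conjInv (proj₁ x))))
      × Σ (DbarInvClass n r αε → SYT n r (zigzagCells αε)) (λ g
        → (∀ x y → pos (g x) ≡ pos (g y) → proj₁ x ≈P proj₁ y)
        × (∀ (Q : SYT n r (zigzagCells αε)) → Σ (DbarInvClass n r αε) λ x → pos (g x) ≡ pos Q)
        × (∀ x → sDesT (g x) ≡ sDesP (proj₁ x)))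
proposition4p3 .(total αε) (suc r) _ (s≤s z≤n) αε (positive , refl) =
  (toTableau , toTableau-injective , toTableau-surjective , toTableau-sDes) ,
  (fromConjInv , fromConjInv-injective , fromConjInv-surjective , fromConjInv-sDes)
  where
  open Bijection zero αε positive
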